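{- Let $m\ge1$ and let $\alpha_1,\ldots,\alpha_m$ be rational numbers, none in $\{0,-1,-2,\ldots\}$, with $\alpha_i-\alpha_j\notin\mathbb{Z}$ for $i\ne j$. Let $n_1,\ldots,n_m$ be positive integers, $n\ge\max\{n_1,\ldots,n_m\}$ an integer, and $N=n_1+\cdots+n_m$. Let $Q_0,P_{0j},Q_i,P_{ij}$ ($1\le i,j\le m$) be the polynomials defined in the context, and let $a_N$ be the coefficient of $z^N$ in $Q_0(z)$. Then $a_N\neq0$ and \[ \Omega(z):=\det\big(Q_i(z)\ \ P_{i1}(z)\ \ \ldots\ \ P_{im}(z)\big)_{i=0,1,\ldots,m}=a_N\,\alpha_1\cdots\alpha_m\,z^{m(N+n)+m}. \]
   Context: Pochhammer symbol: $(\alpha)_0=1$, $(\alpha)_n=\alpha(\alpha+1)\cdots(\alpha+n-1)$. Let $\varphi_j(z)=\sum_{n\ge0}(\alpha_j)_nz^n\in\mathbb{Q}[[z]]$, $j=1,\ldots,m$, and let $\delta_{ij}$ be the Kronecker delta. $Q_0(z)=\sum_{k=0}^N a_kz^k$ is the (existing and unique) polynomial of degree $\le N$ with $a_0=-1/N!$ such that, writing $Q_0(z)\varphi_j(z)=\sum_{\mu\ge0}c_{j\mu}z^\mu$, one has $c_{j\mu}=0$ for $N+n-n_j+1\le\mu\le N+n$ and all $j=1,\ldots,m$; then $P_{0j}(z)=\sum_{\mu=0}^{N+n-n_j}c_{j\mu}z^\mu$. For $i=1,\ldots,m$, $Q_i(z)=\sum_{k=0}^Na_{ik}z^k$ is the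 (existing and unique) polynomial of degree $\le N$ such that, writing $Q_i(z)\varphi_j(z)=\sum_{\mu\ge0}c_{ij\mu}z^\mu$, one has $c_{ij\mu}=0$ for $N+n-n_j+1+\delta_{ij}\le\mu\le N+n+\delta_{ij}$ ($j=1,\ldots,m$) and $c_{ii,N+n-n_i+1}=\alpha_i$; then $P_{ij}(z)=\sum_{\mu=0}^{N+n-n_j+\delta_{ij}}c_{ij\mu}z^\mu$. -}

module Defs where

open import Data.Nat as ℕ using (ℕ; zero; suc; _≡ᵇ_; _!)
open import Data.Nat.Properties using (_!≢0)
open import Data.Integer using (ℤ; -[1+_]; +_)
open import Data.Rational using (ℚ; 0ℚ; 1ℚ; _+_; _*_; -_; _/_)
open import Relation.Binary.PropositionalEquality using (_≡_)
open import Relation.Nullary using (yes; no)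
open import Data.Fin using (Fin; zero; suc; punchIn)
open import Data.Bool using (if_then_else_)

poch : ℚ → ℕ → ℚ
poch α zero    = 1ℚ
poch α (suc n) = poch α n * (α + (+ n / 1))

-- formal power series over ℚ, as coefficient sequences; polynomials are
-- series with finitely many nonzero coefficients
Series : Set
Series = ℕ → ℚ

phi : ℚ → Series
phi α = poch α

sumTo : ℕ → (ℕ → ℚ) → ℚ
sumTo zero    f = 0ℚ
sumTo (suc n) f = sumTo n f + f n

_⊛_ : Series → Series → Series
(f ⊛ g) μ = sumTo (suc μ) (λ k → f k * g (μ ℕ.∸ k))

_⊕_ : Series → Series → Series
(f ⊕ g) μ = f μ + g μ

⊖_ : Series → Series
(⊖ f) μ = - f μ

zeroS : Series
zeroS _ = 0ℚ

oneS : Series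
oneS zero    = 1ℚ
oneS (suc _) = 0ℚ

monomial : ℚ → ℕ → Series
monomial c e k = if k ≡ᵇ e then c else 0ℚ

trunc : ℕ → Series → Series
trunc d f μ = if μ ℕ.≤ᵇ d then f μ else 0ℚ

DegLe : ℕ → Series → Set
DegLe N f = ∀ k → N ℕ.< k → f k ≡ 0ℚ

sumFinS : ∀ {n} → (Fin n → Series) → Series
sumFinS {zero}  f = zeroS
sumFinS {suc n} f = f zero ⊕ sumFinS (λ j → f (suc j))

negPow : ℕ → Series → Series
negPow zero    s = s
negPow (suc k) s = ⊖ negPow k s

det : ∀ n → (Fin n → Fin n → Series) → Series
det zero    M = oneS
det (suc n) M = sumFinS {suc n} (λ j →
  negPow (Data.Fin.toℕ j) (M zero j ⊛ det n (λ r c → M (suc r) (punchIn j c))))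

sumFinℕ : ∀ {n} → (Fin n → ℕ) → ℕ
sumFinℕ {zero}  f = 0
sumFinℕ {suc n} f = f zero ℕ.+ sumFinℕ (λ j → f (suc j))

prodFinℚ : ∀ {n} → (Fin n → ℚ) → ℚ
prodFinℚ {zero}  f = 1ℚ
prodFinℚ {suc n} f = f zero * prodFinℚ (λ j → f (suc j))

minusInvFact : ℕ → ℚ
minusInvFact N = -[1+ 0 ] / (N !)
  where instance _ = N !≢0

δ : ∀ {m} → Fin m → Fin m → ℕ
δ i j with i Data.Fin.≟ j
... | yes _ = 1
... | no _  = 0

OmegaMatrix : (m N n : ℕ) (ns : Fin m → ℕ) (α : Fin m → ℚ)
  (Q₀ : Series) (Q : Fin m → Series) → Fin (suc m) → Fin (suc m) → Series
OmegaMatrix m N n ns α Q₀ Q zero    zero    = Q₀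
OmegaMatrix m N n ns α Q₀ Q zero    (suc j) = trunc (N ℕ.+ n ℕ.∸ ns j) (Q₀ ⊛ phi (α j))
OmegaMatrix m N n ns α Q₀ Q (suc i) zero    = Q i
OmegaMatrix m N n ns α Q₀ Q (suc i) (suc j) = trunc (N ℕ.+ n ℕ.∸ ns j ℕ.+ δ i j) (Q i ⊛ phi (α j))

module Submission where

-- Proof.  (1) a_N ≠ 0: for μ ≥ N the coefficient of z^μ in Q_0 φ_α is
-- (α)_{μ-N} A(α+μ-N) with A(x) = Σ_{k≤N} a_k (x)_{N-k}, a polynomial of
-- degree N, top coefficient a_0 = -1/N! ≠ 0 and A(0) = a_N.  The vanishing
-- conditions give N distinct nonzero roots α_j + t of A, hence A(0) ≠ 0.
-- (2) Ω has degree ≤ m(N+n)+m by the column degree bounds, with top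
-- coefficient the determinant of a block-triangular matrix, a_N α_1⋯α_m;
-- and after the column operations P_ij -= φ_j Q_i (which fix Ω) every
-- column j ≥ 1 has order ≥ N+n+1, so Ω has order ≥ m(N+n)+m too.

open import Defs
open import Algebra.Bundles using (CommutativeRing)


-- How punchIn interacts with itself; this is the bookkeeping behind moving
-- a column of a Laplace expansion to the front.
module PunchIn where
  open import Data.Nat using (suc; _+_)
  open import Data.Nat.Properties using (+-comm; +-suc; +-identityʳ)
  open import Data.Fin using (Fin; zero; suc; punchIn; punchOut; toℕ)
  open import Data.Sum using (_⊎_; inj₁; inj₂)
  open import Function using (_∘_)
  open import Relation.Binary.PropositionalEquality using (_≡_; _≢_; refl; cong; sym; trans)

  -- Removing the column c from the minor at p equals removing (punchIn p c)
  -- first and then the (renumbered) column p.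
  punchIn-punchIn : ∀ {n} (p : Fin (suc (suc n))) (c : Fin (suc n)) (ne : punchIn p c ≢ p) (d : Fin n)
    → punchIn (punchIn p c) (punchIn (punchOut ne) d) ≡ punchIn p (punchIn c d)
  punchIn-punchIn zero c ne d = refl
  punchIn-punchIn (suc p) zero ne d = refl
  punchIn-punchIn {suc n} (suc p) (suc c) ne zero = refl
  punchIn-punchIn {suc n} (suc p) (suc c) ne (suc d) = cong suc (punchIn-punchIn p c (ne ∘ cong suc) d)

  both-suc : ∀ k {a b x y} → a + b + k ≡ x + suc y → suc a + suc b + k ≡ suc x + suc (suc y)
  both-suc k {a} {b} {x} {y} e =
    trans (cong (λ t → suc (t + k)) (+-suc a b)) (trans (cong (λ t → suc (suc t)) e) (cong suc (sym (+-suc x (suc y)))))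

  -- The two ways of reaching that minor have positions of equal parity:
  -- the sums of the removed positions agree, possibly up to 2.
  punchIn-parity : ∀ {n} (p : Fin (suc (suc n))) (c : Fin (suc n)) (ne : punchIn p c ≢ p)
    → (toℕ (punchIn p c) + toℕ (punchOut ne) + 2 ≡ toℕ p + suc (toℕ c))
      ⊎ (toℕ (punchIn p c) + toℕ (punchOut ne) ≡ toℕ p + suc (toℕ c))
  punchIn-parity zero c ne = inj₂ (+-identityʳ _)
  punchIn-parity (suc p) zero ne = inj₁ (trans (+-comm (toℕ p) 2) (cong suc (+-comm 1 (toℕ p))))
  punchIn-parity {suc n} (suc p) (suc c) ne with punchIn-parity p c (ne ∘ cong suc)
  ... | inj₁ e = inj₁ (both-suc 2 e)
  ... | inj₂ e = inj₂ (trans (sym (+-identityʳ _)) (both-suc 0 (trans (+-identityʳ _) e)))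

module Determinant {c ℓ} (R : CommutativeRing c ℓ) where
  open import Data.Nat as ℕ using (ℕ; zero; suc)
  import Data.Nat.Properties as ℕP
  open import Data.Fin as F using (Fin; zero; suc; punchIn; punchOut; toℕ)
  open import Data.Fin.Properties using (punchInᵢ≢i; punchIn-punchOut; punchIn-injective; suc-injective; toℕ<n; toℕ-injective; toℕ-fromℕ<)
  open import Data.Sum using (_⊎_; inj₁; inj₂)
  open import Function using (_∘_)
  open import Relation.Binary.PropositionalEquality as P using (_≡_; _≢_)
  open import Relation.Nullary using (yes; no; ¬_; Dec)
  open import Relation.Nullary.Negation using (contradiction)
  open CommutativeRing R renaming (Carrier to A) hiding (zero)
  open import Algebra.Properties.Ring ring using (-‿distribʳ-*; -1*x≈-x)
  open import Algebra.Properties.AbelianGroup +-abelianGroup using (⁻¹-∙-comm; xyx⁻¹≈y)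
  open import Algebra.Properties.Group +-group using (⁻¹-involutive)
  open import Algebra.Properties.Semiring.Sum semiring public using (sum; sum-cong-≋)
  open import Algebra.Properties.Semiring.Sum semiring using (sum-remove; ∑-distrib-+; sum-replicate-zero; *-distribˡ-sum)
  open import Algebra.Properties.Monoid.Sum *-monoid public using () renaming (sum to product)
  open import Relation.Binary.Reasoning.Setoid setoid
  open import Algebra.Solver.Ring.NaturalCoefficients.Default commutativeSemiring
    using (solve; _:+_; _:*_; _:=_)
  open PunchIn

  Matrix : ℕ → Set c
  Matrix n = Fin n → Fin n → A

  signed : ℕ → A → A
  signed zero x = x
  signed (suc k) x = - signed k x

  minor : ∀ {n} → Fin (suc n) → Matrix (suc n) → Matrix n
  minor j M r c = M (suc r) (punchIn j c)

  -- Laplace expansion along row 0, mirroring det of Defs (which is its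
  -- instance for power series, see SeriesDeterminants.det≗det′)
  det′ : ∀ n → Matrix n → A
  det′ zero M = 1#
  det′ (suc n) M = sum (λ j → signed (toℕ j) (M zero j * det′ n (minor j M)))

  term : ∀ {n} → Matrix (suc n) → Fin (suc n) → A
  term {n} M j = signed (toℕ j) (M zero j * det′ n (minor j M))

  sum-zero : ∀ {n} {f : Fin n → A} → (∀ j → f j ≈ 0#) → sum f ≈ 0#
  sum-zero {n} h = trans (sum-cong-≋ h) (sum-replicate-zero n)

  sum-linear : ∀ {n} s (f g : Fin n → A) → sum (λ j → s * f j + g j) ≈ s * sum f + sum g
  sum-linear s f g = trans (∑-distrib-+ (λ j → s * f j) g) (+-congʳ (sym (*-distribˡ-sum s f)))

  signed-cong : ∀ k {x y} → x ≈ y → signed k x ≈ signed k y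
  signed-cong zero e = e
  signed-cong (suc k) e = -‿cong (signed-cong k e)

  signed-* : ∀ k a x → signed k (a * x) ≈ a * signed k x
  signed-* zero a x = refl
  signed-* (suc k) a x = trans (-‿cong (signed-* k a x)) (-‿distribʳ-* a (signed k x))

  signed-+ : ∀ k x y → signed k (x + y) ≈ signed k x + signed k y
  signed-+ zero x y = refl
  signed-+ (suc k) x y = trans (-‿cong (signed-+ k x y)) (sym (⁻¹-∙-comm _ _))

  signed-0 : ∀ k → signed k 0# ≈ 0#
  signed-0 k = trans (signed-cong k (sym (zeroˡ 0#))) (trans (signed-* k 0# 0#) (zeroˡ _))

  signed-sum : ∀ {n} k (f : Fin n → A) → sum (λ j → signed k (f j)) ≈ signed k (sum f)
  signed-sum {zero} k f = sym (signed-0 k)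
  signed-sum {suc n} k f = trans (+-congˡ (signed-sum k (f ∘ suc))) (sym (signed-+ k _ _))

  signed-signed : ∀ a b x → signed (a ℕ.+ b) x ≡ signed a (signed b x)
  signed-signed zero b x = P.refl
  signed-signed (suc a) b x = P.cong -_ (signed-signed a b x)

  signed-parity : ∀ a b x y z → (a ℕ.+ b ℕ.+ 2 ≡ x ℕ.+ y) ⊎ (a ℕ.+ b ≡ x ℕ.+ y)
    → signed a (signed b z) ≈ signed x (signed y z)
  signed-parity a b x y z (inj₁ e) = begin
    signed a (signed b z) ≡⟨ P.sym (signed-signed a b z) ⟩
    signed (a ℕ.+ b) z ≈⟨ signed-cong (a ℕ.+ b) (⁻¹-involutive z) ⟨
    signed (a ℕ.+ b) (- - z) ≡⟨ P.sym (signed-signed (a ℕ.+ b) 2 z) ⟩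
    signed (a ℕ.+ b ℕ.+ 2) z ≡⟨ P.cong (λ t → signed t z) e ⟩
    signed (x ℕ.+ y) z ≡⟨ signed-signed x y z ⟩
    signed x (signed y z) ∎
  signed-parity a b x y z (inj₂ e) = begin
    signed a (signed b z) ≡⟨ P.sym (signed-signed a b z) ⟩
    signed (a ℕ.+ b) z ≡⟨ P.cong (λ t → signed t z) e ⟩
    signed (x ℕ.+ y) z ≡⟨ signed-signed x y z ⟩
    signed x (signed y z) ∎

  det-cong : ∀ n {M N : Matrix n} → (∀ i j → M i j ≈ N i j) → det′ n M ≈ det′ n N
  det-cong zero h = refl
  det-cong (suc n) h = sum-cong-≋ λ j →
    signed-cong (toℕ j) (*-cong (h zero j) (det-cong n (λ r c → h (suc r) (punchIn j c))))

  det-linear : ∀ n (M X Y : Matrix n) (q : Fin n) s →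
    (∀ i j → j ≢ q → M i j ≈ X i j) → (∀ i j → j ≢ q → M i j ≈ Y i j) →
    (∀ i → M i q ≈ s * X i q + Y i q) → det′ n M ≈ s * det′ n X + det′ n Y
  det-linear (suc n) M X Y q s hX hY hq = trans (sum-cong-≋ split) (sum-linear s (term X) (term Y))
    where
    -- each term of the expansion splits; for j = q directly, otherwise by
    -- linearity of the minor in the column that q becomes there
    entries : ∀ j → M zero j * det′ n (minor j M) ≈ s * (X zero j * det′ n (minor j X)) + Y zero j * det′ n (minor j Y)
    entries j with j F.≟ q
    ... | yes P.refl = begin
      M zero j * det′ n (minor j M) ≈⟨ *-cong (hq zero) (det-cong n λ r c → hX (suc r) (punchIn j c) (punchInᵢ≢i j c)) ⟩
      (s * X zero j + Y zero j) * det′ n (minor j X)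
        ≈⟨ solve 4 (λ s x y d → ((s :* x) :+ y) :* d := (s :* (x :* d)) :+ (y :* d)) refl s _ _ _ ⟩
      s * (X zero j * det′ n (minor j X)) + Y zero j * det′ n (minor j X)
        ≈⟨ +-congˡ (*-congˡ (det-cong n λ r c → trans (sym (hX (suc r) (punchIn j c) (punchInᵢ≢i j c)))
                                                       (hY (suc r) (punchIn j c) (punchInᵢ≢i j c)))) ⟩
      s * (X zero j * det′ n (minor j X)) + Y zero j * det′ n (minor j Y) ∎
    ... | no j≢q = begin
      M zero j * det′ n (minor j M) ≈⟨ *-congˡ minorLinear ⟩
      M zero j * (s * det′ n (minor j X) + det′ n (minor j Y))
        ≈⟨ solve 4 (λ m s x y → m :* ((s :* x) :+ y) := (s :* (m :* x)) :+ (m :* y)) refl _ s _ _ ⟩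
      s * (M zero j * det′ n (minor j X)) + M zero j * det′ n (minor j Y)
        ≈⟨ +-cong (*-congˡ (*-congʳ (hX zero j j≢q))) (*-congʳ (hY zero j j≢q)) ⟩
      s * (X zero j * det′ n (minor j X)) + Y zero j * det′ n (minor j Y) ∎
      where
      q′ : Fin n
      q′ = punchOut j≢q
      off : ∀ c → c ≢ q′ → punchIn j c ≢ q
      off c c≢ e = c≢ (punchIn-injective j c q′ (P.trans e (P.sym (punchIn-punchOut j≢q))))
      minorLinear : det′ n (minor j M) ≈ s * det′ n (minor j X) + det′ n (minor j Y)
      minorLinear = det-linear n (minor j M) (minor j X) (minor j Y) q′ s
        (λ r c c≢ → hX (suc r) (punchIn j c) (off c c≢))
        (λ r c c≢ → hY (suc r) (punchIn j c) (off c c≢))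
        (λ r → P.subst (λ t → M (suc r) t ≈ s * X (suc r) t + Y (suc r) t) (P.sym (punchIn-punchOut j≢q)) (hq (suc r)))
    split : ∀ j → term M j ≈ s * term X j + term Y j
    split j = trans (signed-cong (toℕ j) (entries j)) (trans (signed-+ (toℕ j) _ _) (+-congʳ (signed-* (toℕ j) s _)))

  -- A matrix with a zero column has determinant 0: by linearity with
  -- s = -1, det M ≈ -(det M) + det M.
  det-zeroColumn : ∀ n (M : Matrix n) q → (∀ i → M i q ≈ 0#) → det′ n M ≈ 0#
  det-zeroColumn n M q h = begin
    det′ n M ≈⟨ det-linear n M M M q (- 1#) (λ _ _ _ → refl) (λ _ _ _ → refl) cancelling ⟩
    - 1# * det′ n M + det′ n M ≈⟨ +-congʳ (-1*x≈-x _) ⟩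
    - det′ n M + det′ n M ≈⟨ -‿inverseˡ _ ⟩
    0# ∎
    where
    cancelling : ∀ i → M i q ≈ - 1# * M i q + M i q
    cancelling i = trans (h i) (sym (trans (+-cong (trans (*-congˡ (h i)) (zeroʳ _)) (h i)) (+-identityˡ 0#)))

  withColumn : ∀ {n} → Matrix n → Fin n → (Fin n → A) → Matrix n
  withColumn M q v i j with j F.≟ q
  ... | yes _ = v i
  ... | no _ = M i j

  withColumn-at : ∀ {n} (M : Matrix n) q v i → withColumn M q v i q ≡ v i
  withColumn-at M q v i with q F.≟ q
  ... | yes _ = P.refl
  ... | no q≢q = contradiction P.refl q≢q

  withColumn-off : ∀ {n} (M : Matrix n) q v i j → j ≢ q → withColumn M q v i j ≡ M i j
  withColumn-off M q v i j j≢q with j F.≟ q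
  ... | yes e = contradiction e j≢q
  ... | no _ = P.refl

  det-scaleColumn : ∀ n (M X : Matrix n) q s → (∀ i j → j ≢ q → M i j ≈ X i j) →
    (∀ i → M i q ≈ s * X i q) → det′ n M ≈ s * det′ n X
  det-scaleColumn n M X q s hX hq = begin
    det′ n M ≈⟨ det-linear n M X Z q s hX (λ i j j≢q → reflexive (P.sym (withColumn-off M q _ i j j≢q))) colq ⟩
    s * det′ n X + det′ n Z ≈⟨ +-congˡ (det-zeroColumn n Z q λ i → reflexive (withColumn-at M q _ i)) ⟩
    s * det′ n X + 0# ≈⟨ +-identityʳ _ ⟩
    s * det′ n X ∎
    where
    Z : Matrix n
    Z = withColumn M q (λ _ → 0#)
    colq : ∀ i → M i q ≈ s * X i q + Z i q
    colq i = trans (hq i) (trans (sym (+-identityʳ _)) (+-congˡ (reflexive (P.sym (withColumn-at M q _ i)))))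

  det-moveColumn : ∀ n (K M : Matrix (suc n)) (p : Fin (suc n)) → (∀ i → K i p ≈ M i zero) →
    (∀ i c → K i (punchIn p c) ≈ M i (suc c)) → det′ (suc n) K ≈ signed (toℕ p) (det′ (suc n) M)
  det-moveColumn zero K M zero h0 h1 = det-cong 1 {K} {M} λ { zero zero → h0 zero }
  det-moveColumn (suc n) K M p h0 h1 = begin
    sum (term K) ≈⟨ sum-remove {i = p} (term K) ⟩
    term K p + sum (λ c → term K (punchIn p c)) ≈⟨ +-cong atP (sum-cong-≋ offP) ⟩
    signed (toℕ p) (term M zero) + sum (λ c → signed (toℕ p) (term M (suc c)))
      ≈⟨ +-congˡ (signed-sum (toℕ p) (λ c → term M (suc c))) ⟩
    signed (toℕ p) (term M zero) + signed (toℕ p) (sum (λ c → term M (suc c)))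
      ≈⟨ signed-+ (toℕ p) _ _ ⟨
    signed (toℕ p) (det′ (suc (suc n)) M) ∎
    where
    atP : term K p ≈ signed (toℕ p) (term M zero)
    atP = signed-cong (toℕ p) (*-cong (h0 zero) (det-cong (suc n) (λ r c → h1 (suc r) c)))
    -- the term of column punchIn p c is, by induction on the minor, the
    -- term of column (suc c) of M with a sign of the same parity
    offP : ∀ c → term K (punchIn p c) ≈ signed (toℕ p) (term M (suc c))
    offP c = begin
      signed (toℕ q) (K zero q * det′ (suc n) (minor q K)) ≈⟨ signed-cong (toℕ q) (*-cong (h1 zero c) minorMoved) ⟩
      signed (toℕ q) (M zero (suc c) * signed (toℕ p′) D) ≈⟨ signed-cong (toℕ q) (signed-* (toℕ p′) _ D) ⟨
      signed (toℕ q) (signed (toℕ p′) (M zero (suc c) * D))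
        ≈⟨ signed-parity (toℕ q) (toℕ p′) (toℕ p) (suc (toℕ c)) _ (punchIn-parity p c q≢p) ⟩
      signed (toℕ p) (term M (suc c)) ∎
      where
      q : Fin (suc (suc n))
      q = punchIn p c
      q≢p : q ≢ p
      q≢p = punchInᵢ≢i p c
      p′ : Fin (suc n)
      p′ = punchOut q≢p
      D : A
      D = det′ (suc n) (minor (suc c) M)
      minorMoved : det′ (suc n) (minor q K) ≈ signed (toℕ p′) D
      minorMoved = det-moveColumn n (minor q K) (minor (suc c) M) p′
        (λ r → trans (reflexive (P.cong (K (suc r)) (punchIn-punchOut q≢p))) (h0 (suc r)))
        (λ r d → trans (reflexive (P.cong (K (suc r)) (punchIn-punchIn p c q≢p d))) (h1 (suc r) (punchIn c d)))

  det-proportionalColumn : ∀ n (M : Matrix (suc n)) (q : Fin n) g →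
    (∀ i → M i (suc q) ≈ g * M i zero) → det′ (suc n) M ≈ 0#
  det-proportionalColumn (suc n) M q g h = begin
    term M zero + sum (λ c → term M (suc c)) ≈⟨ +-congˡ (sum-remove {i = q} (λ c → term M (suc c))) ⟩
    term M zero + (term M (suc q) + sum (λ d → term M (suc (punchIn q d))))
      ≈⟨ +-congˡ (+-congˡ (sum-zero others)) ⟩
    term M zero + (term M (suc q) + 0#) ≈⟨ +-congˡ (+-identityʳ _) ⟩
    term M zero + term M (suc q) ≈⟨ +-cong atZero atQ ⟩
    (g * M zero zero) * signed (toℕ q) D + - ((g * M zero zero) * signed (toℕ q) D) ≈⟨ -‿inverseʳ _ ⟩
    0# ∎
    where
    D : A
    D = det′ (suc n) (minor (suc q) M)
    -- every other minor still contains both proportional columns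
    others : ∀ d → term M (suc (punchIn q d)) ≈ 0#
    others d = trans (signed-cong (toℕ x) (trans (*-congˡ vanishes) (zeroʳ _))) (signed-0 (toℕ x))
      where
      x : Fin (suc (suc n))
      x = suc (punchIn q d)
      d≢ : punchIn q d ≢ q
      d≢ = punchInᵢ≢i q d
      vanishes = det-proportionalColumn n (minor x M) (punchOut d≢) g
        (λ r → trans (reflexive (P.cong (λ t → M (suc r) (suc t)) (punchIn-punchOut d≢))) (h (suc r)))
    -- the minors at columns 0 and q differ by moving a column and scaling it by g
    M₀ : Matrix (suc n)
    M₀ = minor zero M
    X : Matrix (suc n)
    X = withColumn M₀ q (λ r → M (suc r) zero)
    scaled : det′ (suc n) M₀ ≈ g * det′ (suc n) X
    scaled = det-scaleColumn (suc n) M₀ X q g (λ i j j≢q → reflexive (P.sym (withColumn-off M₀ q _ i j j≢q)))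
      (λ i → trans (h (suc i)) (*-congˡ (reflexive (P.sym (withColumn-at M₀ q _ i)))))
    moved : det′ (suc n) X ≈ signed (toℕ q) D
    moved = det-moveColumn n X (minor (suc q) M) q (λ i → reflexive (withColumn-at M₀ q _ i))
      (λ i c → reflexive (withColumn-off M₀ q _ i (punchIn q c) (punchInᵢ≢i q c)))
    atZero : term M zero ≈ (g * M zero zero) * signed (toℕ q) D
    atZero = begin
      M zero zero * det′ (suc n) M₀ ≈⟨ *-congˡ (trans scaled (*-congˡ moved)) ⟩
      M zero zero * (g * signed (toℕ q) D) ≈⟨ solve 3 (λ m g y → m :* (g :* y) := (g :* m) :* y) refl _ g _ ⟩
      (g * M zero zero) * signed (toℕ q) D ∎
    atQ : term M (suc q) ≈ - ((g * M zero zero) * signed (toℕ q) D)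
    atQ = -‿cong (trans (signed-cong (toℕ q) (*-congʳ (h zero))) (signed-* (toℕ q) _ D))

  det-columnOperation : ∀ n (M M′ : Matrix (suc n)) (q : Fin n) g → (∀ i j → j ≢ suc q → M′ i j ≈ M i j) →
    (∀ i → M′ i (suc q) ≈ M i (suc q) - g * M i zero) → det′ (suc n) M′ ≈ det′ (suc n) M
  det-columnOperation n M M′ q g hoff hq = sym (begin
    det′ (suc n) M ≈⟨ det-linear (suc n) M X M′ (suc q) 1#
                       (λ i j j≢ → reflexive (P.sym (withColumn-off M (suc q) _ i j j≢)))
                       (λ i j j≢ → sym (hoff i j j≢)) colq ⟩
    1# * det′ (suc n) X + det′ (suc n) M′ ≈⟨ +-congʳ (trans (*-congˡ vanishes) (zeroʳ 1#)) ⟩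
    0# + det′ (suc n) M′ ≈⟨ +-identityˡ _ ⟩
    det′ (suc n) M′ ∎)
    where
    X : Matrix (suc n)
    X = withColumn M (suc q) (λ i → g * M i zero)
    vanishes : det′ (suc n) X ≈ 0#
    vanishes = det-proportionalColumn n X q g λ i → trans (reflexive (withColumn-at M (suc q) _ i))
      (*-congˡ (reflexive (P.sym (withColumn-off M (suc q) (λ i → g * M i zero) i zero (λ ())))))
    colq : ∀ i → M i (suc q) ≈ 1# * X i (suc q) + M′ i (suc q)
    colq i = sym (begin
      1# * X i (suc q) + M′ i (suc q) ≈⟨ +-cong (trans (*-identityˡ _) (reflexive (withColumn-at M (suc q) _ i))) (hq i) ⟩
      g * M i zero + (M i (suc q) - g * M i zero)
        ≈⟨ +-assoc _ _ _ ⟨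
      g * M i zero + M i (suc q) - g * M i zero ≈⟨ xyx⁻¹≈y _ _ ⟩
      M i (suc q) ∎)

  select : ∀ {p} {Q : Set p} → Dec Q → A → A → A
  select (yes _) a b = a
  select (no _) a b = b

  select-yes : ∀ {p} {Q : Set p} (d : Dec Q) a b → Q → select d a b ≡ a
  select-yes (yes _) a b _ = P.refl
  select-yes (no ¬q) a b q = contradiction q ¬q

  select-no : ∀ {p} {Q : Set p} (d : Dec Q) a b → ¬ Q → select d a b ≡ b
  select-no (yes q) a b ¬q = contradiction q ¬q
  select-no (no _) a b _ = P.refl

  partially : ∀ {n} → Matrix (suc n) → Matrix (suc n) → ℕ → Matrix (suc n)
  partially M M′ k i zero = M i zero
  partially M M′ k i (suc j) = select (toℕ j ℕ.<? k) (M′ i (suc j)) (M i (suc j))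

  -- Treating one more column is a single column operation (or nothing, once k ≥ n).
  partially-step : ∀ n (M M′ : Matrix (suc n)) (g : Fin n → A) →
    (∀ i j → M′ i (suc j) ≈ M i (suc j) - g j * M i zero) →
    ∀ k → det′ (suc n) (partially M M′ (suc k)) ≈ det′ (suc n) (partially M M′ k)
  partially-step n M M′ g h k with k ℕ.<? n
  ... | yes k<n = det-columnOperation n (partially M M′ k) (partially M M′ (suc k)) q (g q) untouched treated
    where
    q : Fin n
    q = F.fromℕ< k<n
    toℕq : toℕ q ≡ k
    toℕq = toℕ-fromℕ< k<n
    untouched : ∀ i j → j ≢ suc q → partially M M′ (suc k) i j ≈ partially M M′ k i j
    untouched i zero _ = refl
    untouched i (suc j) j≢q with toℕ j ℕ.<? k
    ... | yes j<k = reflexive (select-yes (toℕ j ℕ.<? suc k) _ _ (ℕP.m<n⇒m<1+n j<k))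
    ... | no j≮k = reflexive (select-no (toℕ j ℕ.<? suc k) _ _ λ j<1+k →
            j≢q (P.cong suc (toℕ-injective (P.trans (ℕP.≤-antisym (ℕP.≤-pred j<1+k) (ℕP.≮⇒≥ j≮k)) (P.sym toℕq)))))
    treated : ∀ i → partially M M′ (suc k) i (suc q) ≈ partially M M′ k i (suc q) - g q * M i zero
    treated i = trans (reflexive (select-yes (toℕ q ℕ.<? suc k) _ _ (P.subst (ℕ._< suc k) (P.sym toℕq) (ℕP.n<1+n k))))
      (trans (h i q) (+-congʳ (reflexive (P.sym (select-no (toℕ q ℕ.<? k) _ _ (P.subst (λ t → ¬ (t ℕ.< k)) (P.sym toℕq) (ℕP.n≮n k)))))))
  ... | no k≮n = det-cong (suc n) same
    where
    same : ∀ i j → partially M M′ (suc k) i j ≈ partially M M′ k i j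
    same i zero = refl
    same i (suc j) = reflexive (P.trans (select-yes (toℕ j ℕ.<? suc k) _ _ (ℕP.m<n⇒m<1+n j<k))
                                        (P.sym (select-yes (toℕ j ℕ.<? k) _ _ j<k)))
      where
      j<k : toℕ j ℕ.< k
      j<k = ℕP.<-≤-trans (toℕ<n j) (ℕP.≮⇒≥ k≮n)

  -- Subtracting g j·(column 0) from every column (suc j) at once leaves the
  -- determinant unchanged: treat the columns one at a time.
  det-columnOperations : ∀ n (M M′ : Matrix (suc n)) (g : Fin n → A) → (∀ i → M′ i zero ≈ M i zero) →
    (∀ i j → M′ i (suc j) ≈ M i (suc j) - g j * M i zero) → det′ (suc n) M′ ≈ det′ (suc n) M
  det-columnOperations n M M′ g h0 h = begin
    det′ (suc n) M′ ≈⟨ det-cong (suc n) allTreated ⟩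
    det′ (suc n) (partially M M′ n) ≈⟨ stages n ⟩
    det′ (suc n) M ∎
    where
    allTreated : ∀ i j → M′ i j ≈ partially M M′ n i j
    allTreated i zero = h0 i
    allTreated i (suc j) = reflexive (P.sym (select-yes (toℕ j ℕ.<? n) _ _ (toℕ<n j)))
    noneTreated : ∀ i j → partially M M′ zero i j ≈ M i j
    noneTreated i zero = refl
    noneTreated i (suc j) = reflexive (select-no (toℕ j ℕ.<? zero) (M′ i (suc j)) (M i (suc j)) λ ())
    stages : ∀ k → det′ (suc n) (partially M M′ k) ≈ det′ (suc n) M
    stages zero = det-cong (suc n) noneTreated
    stages (suc k) = trans (partially-step n M M′ g h k) (stages k)

  det-firstRow : ∀ n (M : Matrix (suc n)) → (∀ j → M zero (suc j) ≈ 0#) →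
    det′ (suc n) M ≈ M zero zero * det′ n (minor zero M)
  det-firstRow n M h0 = begin
    term M zero + sum (λ j → term M (suc j)) ≈⟨ +-congˡ (sum-zero vanishing) ⟩
    term M zero + 0# ≈⟨ +-identityʳ _ ⟩
    M zero zero * det′ n (minor zero M) ∎
    where
    vanishing : ∀ j → term M (suc j) ≈ 0#
    vanishing j = trans (signed-cong (suc (toℕ j)) (trans (*-congʳ (h0 j)) (zeroˡ _))) (signed-0 (suc (toℕ j)))

  det-diagonal : ∀ n (M : Matrix n) → (∀ i j → i ≢ j → M i j ≈ 0#) → det′ n M ≈ product (λ i → M i i)
  det-diagonal zero M h = refl
  det-diagonal (suc n) M h = trans (det-firstRow n M (λ j → h zero (suc j) (λ ())))
    (*-congˡ (det-diagonal n (minor zero M) λ i j i≢j → h (suc i) (suc j) (i≢j ∘ suc-injective)))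


module FiniteSums where
  open import Data.Nat as ℕ using (ℕ; zero; suc; _∸_)
  import Data.Nat.Properties as ℕP
  open import Data.Rational using (ℚ; 0ℚ; _+_; _*_)
  import Data.Rational.Properties as ℚP
  open import Data.Rational.Solver using (module +-*-Solver)
  open +-*-Solver using (solve; _:+_; _:=_)
  open import Relation.Binary.PropositionalEquality using (_≡_; _≢_; refl; cong; cong₂; sym; trans)
  open import Relation.Binary.PropositionalEquality.Properties using (module ≡-Reasoning)
  open import Relation.Nullary using (yes; no)
  open import Function using (_∘_)
  open ≡-Reasoning

  sumTo-cong : ∀ n {f g : ℕ → ℚ} → (∀ k → k ℕ.< n → f k ≡ g k) → sumTo n f ≡ sumTo n g
  sumTo-cong zero h = refl
  sumTo-cong (suc n) h = cong₂ _+_ (sumTo-cong n (λ k k<n → h k (ℕP.m<n⇒m<1+n k<n))) (h n (ℕP.n<1+n n))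

  sumTo-+ : ∀ n (f g : ℕ → ℚ) → sumTo n (λ k → f k + g k) ≡ sumTo n f + sumTo n g
  sumTo-+ zero f g = refl
  sumTo-+ (suc n) f g = trans (cong (_+ (f n + g n)) (sumTo-+ n f g))
    (solve 4 (λ a b c d → (a :+ b) :+ (c :+ d) := (a :+ c) :+ (b :+ d)) refl (sumTo n f) (sumTo n g) (f n) (g n))

  sumTo-*ˡ : ∀ n a (f : ℕ → ℚ) → a * sumTo n f ≡ sumTo n (λ k → a * f k)
  sumTo-*ˡ zero a f = ℚP.*-zeroʳ a
  sumTo-*ˡ (suc n) a f = trans (ℚP.*-distribˡ-+ a (sumTo n f) (f n)) (cong (_+ (a * f n)) (sumTo-*ˡ n a f))

  sumTo-*ʳ : ∀ n a (f : ℕ → ℚ) → sumTo n f * a ≡ sumTo n (λ k → f k * a)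
  sumTo-*ʳ n a f = trans (ℚP.*-comm (sumTo n f) a) (trans (sumTo-*ˡ n a f) (sumTo-cong n (λ k _ → ℚP.*-comm a (f k))))

  sumTo-zero : ∀ n (f : ℕ → ℚ) → (∀ k → k ℕ.< n → f k ≡ 0ℚ) → sumTo n f ≡ 0ℚ
  sumTo-zero n f h = trans (sumTo-cong n h) (zeros n)
    where
    zeros : ∀ n → sumTo n (λ _ → 0ℚ) ≡ 0ℚ
    zeros zero = refl
    zeros (suc n) = cong (_+ 0ℚ) (zeros n)

  sumTo-single : ∀ n (f : ℕ → ℚ) j → j ℕ.< n → (∀ k → k ℕ.< n → k ≢ j → f k ≡ 0ℚ) → sumTo n f ≡ f j
  sumTo-single (suc n) f j j<1+n h with j ℕP.≟ n
  ... | yes refl = trans (cong (_+ f j) (sumTo-zero n f (λ k k<n → h k (ℕP.m<n⇒m<1+n k<n) (λ e → ℕP.<-irrefl e k<n))))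
                         (ℚP.+-identityˡ (f j))
  ... | no j≢n = trans (cong₂ _+_ (sumTo-single n f j (ℕP.≤∧≢⇒< (ℕP.≤-pred j<1+n) j≢n) (λ k k<n → h k (ℕP.m<n⇒m<1+n k<n)))
                                  (h n (ℕP.n<1+n n) (j≢n ∘ sym)))
                       (ℚP.+-identityʳ (f j))

  sumTo-prefix : ∀ m d (f : ℕ → ℚ) → (∀ k → m ℕ.≤ k → f k ≡ 0ℚ) → sumTo (m ℕ.+ d) f ≡ sumTo m f
  sumTo-prefix m zero f h = cong (λ t → sumTo t f) (ℕP.+-identityʳ m)
  sumTo-prefix m (suc d) f h = begin
    sumTo (m ℕ.+ suc d) f ≡⟨ cong (λ t → sumTo t f) (ℕP.+-suc m d) ⟩
    sumTo (m ℕ.+ d) f + f (m ℕ.+ d) ≡⟨ cong₂ _+_ (sumTo-prefix m d f h) (h (m ℕ.+ d) (ℕP.m≤m+n m d)) ⟩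
    sumTo m f + 0ℚ ≡⟨ ℚP.+-identityʳ _ ⟩
    sumTo m f ∎

  sumTo-shift : ∀ n (f : ℕ → ℚ) → sumTo (suc n) f ≡ f 0 + sumTo n (λ k → f (suc k))
  sumTo-shift zero f = trans (ℚP.+-identityˡ (f 0)) (sym (ℚP.+-identityʳ (f 0)))
  sumTo-shift (suc n) f = trans (cong (_+ f (suc n)) (sumTo-shift n f)) (ℚP.+-assoc (f 0) (sumTo n (λ k → f (suc k))) (f (suc n)))

  sumTo-reverse : ∀ μ (f : ℕ → ℚ) → sumTo (suc μ) f ≡ sumTo (suc μ) (λ k → f (μ ∸ k))
  sumTo-reverse zero f = refl
  sumTo-reverse (suc μ) f = begin
    sumTo (suc μ) f + f (suc μ) ≡⟨ cong (_+ f (suc μ)) (sumTo-reverse μ f) ⟩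
    sumTo (suc μ) (λ k → f (μ ∸ k)) + f (suc μ) ≡⟨ ℚP.+-comm (sumTo (suc μ) (λ k → f (μ ∸ k))) (f (suc μ)) ⟩
    f (suc μ) + sumTo (suc μ) (λ k → f (μ ∸ k)) ≡⟨ sym (sumTo-shift (suc μ) (λ k → f (suc μ ∸ k))) ⟩
    sumTo (suc (suc μ)) (λ k → f (suc μ ∸ k)) ∎

  sumTo-triangle : ∀ μ (F : ℕ → ℕ → ℚ) →
    sumTo (suc μ) (λ k → sumTo (suc k) (λ i → F i k)) ≡ sumTo (suc μ) (λ i → sumTo (suc (μ ∸ i)) (λ l → F i (i ℕ.+ l)))
  sumTo-triangle zero F = refl
  sumTo-triangle (suc μ) F = begin
    sumTo (suc μ) (λ k → sumTo (suc k) (λ i → F i k)) + sumTo (suc (suc μ)) (λ i → F i (suc μ))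
      ≡⟨ cong (_+ sumTo (suc (suc μ)) (λ i → F i (suc μ))) (sumTo-triangle μ F) ⟩
    rows + (column + F (suc μ) (suc μ)) ≡⟨ sym (ℚP.+-assoc rows column _) ⟩
    (rows + column) + F (suc μ) (suc μ)
      ≡⟨ cong₂ _+_ (sym (trans (sumTo-cong (suc μ) extend) (sumTo-+ (suc μ) _ _)))
                   (trans (cong (F (suc μ)) (sym (ℕP.+-identityʳ (suc μ)))) (sym (ℚP.+-identityˡ _))) ⟩
    sumTo (suc μ) (λ i → sumTo (suc (suc μ ∸ i)) (λ l → F i (i ℕ.+ l))) + sumTo 1 (λ l → F (suc μ) (suc μ ℕ.+ l))
      ≡⟨ cong (λ t → sumTo (suc μ) (λ i → sumTo (suc (suc μ ∸ i)) (λ l → F i (i ℕ.+ l))) + sumTo (suc t) (λ l → F (suc μ) (suc μ ℕ.+ l)))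
              (sym (ℕP.n∸n≡0 (suc μ))) ⟩
    sumTo (suc (suc μ)) (λ i → sumTo (suc (suc μ ∸ i)) (λ l → F i (i ℕ.+ l))) ∎
    where
    rows : ℚ
    rows = sumTo (suc μ) (λ i → sumTo (suc (μ ∸ i)) (λ l → F i (i ℕ.+ l)))
    column : ℚ
    column = sumTo (suc μ) (λ i → F i (suc μ))
    extend : ∀ i → i ℕ.< suc μ →
      sumTo (suc (suc μ ∸ i)) (λ l → F i (i ℕ.+ l)) ≡ sumTo (suc (μ ∸ i)) (λ l → F i (i ℕ.+ l)) + F i (suc μ)
    extend i i<1+μ = begin
      sumTo (suc (suc μ ∸ i)) (λ l → F i (i ℕ.+ l))
        ≡⟨ cong (λ t → sumTo (suc t) (λ l → F i (i ℕ.+ l))) (ℕP.+-∸-assoc 1 (ℕP.≤-pred i<1+μ)) ⟩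
      sumTo (suc (μ ∸ i)) (λ l → F i (i ℕ.+ l)) + F i (i ℕ.+ suc (μ ∸ i))
        ≡⟨ cong (λ t → sumTo (suc (μ ∸ i)) (λ l → F i (i ℕ.+ l)) + F i t)
                (trans (ℕP.+-suc i (μ ∸ i)) (cong suc (ℕP.m+[n∸m]≡n (ℕP.≤-pred i<1+μ)))) ⟩
      sumTo (suc (μ ∸ i)) (λ l → F i (i ℕ.+ l)) + F i (suc μ) ∎


module PowerSeriesRing where
  open import Data.Nat as ℕ using (suc; _∸_)
  import Data.Nat.Properties as ℕP
  open import Data.Rational using (0ℚ; 1ℚ; _+_; _*_; -_)
  import Data.Rational.Properties as ℚP
  open import Data.Product using (_,_)
  open import Algebra.Structures using (IsCommutativeRing)
  open import Relation.Binary.PropositionalEquality using (_≗_; refl; cong; cong₂; sym; trans)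
  open import Relation.Binary.PropositionalEquality.Properties using (module ≡-Reasoning)
  open ≡-Reasoning
  open FiniteSums

  ⊛-cong : ∀ {f f′ g g′} → f ≗ f′ → g ≗ g′ → (f ⊛ g) ≗ (f′ ⊛ g′)
  ⊛-cong ef eg μ = sumTo-cong (suc μ) (λ k _ → cong₂ _*_ (ef k) (eg (μ ∸ k)))

  ⊛-comm : ∀ f g → (f ⊛ g) ≗ (g ⊛ f)
  ⊛-comm f g μ = begin
    sumTo (suc μ) (λ k → f k * g (μ ∸ k)) ≡⟨ sumTo-reverse μ _ ⟩
    sumTo (suc μ) (λ k → f (μ ∸ k) * g (μ ∸ (μ ∸ k)))
      ≡⟨ sumTo-cong (suc μ) (λ k k≤μ → trans (cong (λ t → f (μ ∸ k) * g t) (ℕP.m∸[m∸n]≡n (ℕP.≤-pred k≤μ)))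
                                             (ℚP.*-comm (f (μ ∸ k)) (g k))) ⟩
    sumTo (suc μ) (λ k → g k * f (μ ∸ k)) ∎

  ⊛-assoc : ∀ f g h → ((f ⊛ g) ⊛ h) ≗ (f ⊛ (g ⊛ h))
  ⊛-assoc f g h μ = begin
    sumTo (suc μ) (λ k → sumTo (suc k) (λ i → f i * g (k ∸ i)) * h (μ ∸ k))
      ≡⟨ sumTo-cong (suc μ) (λ k _ → sumTo-*ʳ (suc k) (h (μ ∸ k)) (λ i → f i * g (k ∸ i))) ⟩
    sumTo (suc μ) (λ k → sumTo (suc k) (λ i → f i * g (k ∸ i) * h (μ ∸ k)))
      ≡⟨ sumTo-triangle μ (λ i k → f i * g (k ∸ i) * h (μ ∸ k)) ⟩
    sumTo (suc μ) (λ i → sumTo (suc (μ ∸ i)) (λ l → f i * g ((i ℕ.+ l) ∸ i) * h (μ ∸ (i ℕ.+ l))))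
      ≡⟨ sumTo-cong (suc μ) (λ i _ → sumTo-cong (suc (μ ∸ i)) (λ l _ →
           trans (cong₂ (λ a b → f i * g a * h b) (ℕP.m+n∸m≡n i l) (sym (ℕP.∸-+-assoc μ i l)))
                 (ℚP.*-assoc (f i) (g l) (h (μ ∸ i ∸ l))))) ⟩
    sumTo (suc μ) (λ i → sumTo (suc (μ ∸ i)) (λ l → f i * (g l * h (μ ∸ i ∸ l))))
      ≡⟨ sumTo-cong (suc μ) (λ i _ → sym (sumTo-*ˡ (suc (μ ∸ i)) (f i) (λ l → g l * h (μ ∸ i ∸ l)))) ⟩
    sumTo (suc μ) (λ i → f i * sumTo (suc (μ ∸ i)) (λ l → g l * h (μ ∸ i ∸ l))) ∎

  ⊛-distribˡ : ∀ f g h → (f ⊛ (g ⊕ h)) ≗ ((f ⊛ g) ⊕ (f ⊛ h))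
  ⊛-distribˡ f g h μ = trans (sumTo-cong (suc μ) (λ k _ → ℚP.*-distribˡ-+ (f k) (g (μ ∸ k)) (h (μ ∸ k))))
                             (sumTo-+ (suc μ) (λ k → f k * g (μ ∸ k)) (λ k → f k * h (μ ∸ k)))

  ⊛-identityˡ : ∀ f → (oneS ⊛ f) ≗ f
  ⊛-identityˡ f μ = begin
    sumTo (suc μ) (λ k → oneS k * f (μ ∸ k)) ≡⟨ sumTo-shift μ (λ k → oneS k * f (μ ∸ k)) ⟩
    1ℚ * f μ + sumTo μ (λ k → 0ℚ * f (μ ∸ suc k))
      ≡⟨ cong₂ _+_ (ℚP.*-identityˡ (f μ)) (sumTo-zero μ _ (λ k _ → ℚP.*-zeroˡ (f (μ ∸ suc k)))) ⟩
    f μ + 0ℚ ≡⟨ ℚP.+-identityʳ (f μ) ⟩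
    f μ ∎

  series-isCommutativeRing : IsCommutativeRing _≗_ _⊕_ _⊛_ ⊖_ zeroS oneS
  series-isCommutativeRing = record
    { isRing = record
      { +-isAbelianGroup = record
        { isGroup = record
          { isMonoid = record
            { isSemigroup = record
              { isMagma = record
                { isEquivalence = record { refl = λ k → refl ; sym = λ e k → sym (e k) ; trans = λ e₁ e₂ k → trans (e₁ k) (e₂ k) }
                ; ∙-cong = λ e₁ e₂ k → cong₂ _+_ (e₁ k) (e₂ k) }
              ; assoc = λ f g h k → ℚP.+-assoc (f k) (g k) (h k) }
            ; identity = (λ f k → ℚP.+-identityˡ (f k)) , (λ f k → ℚP.+-identityʳ (f k)) }
          ; inverse = (λ f k → ℚP.+-inverseˡ (f k)) , (λ f k → ℚP.+-inverseʳ (f k))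
          ; ⁻¹-cong = λ e k → cong -_ (e k) }
        ; comm = λ f g k → ℚP.+-comm (f k) (g k) }
      ; *-cong = ⊛-cong
      ; *-assoc = ⊛-assoc
      ; *-identity = ⊛-identityˡ , (λ f k → trans (⊛-comm f oneS k) (⊛-identityˡ f k))
      ; distrib = ⊛-distribˡ , (λ f g h k → trans (⊛-comm (g ⊕ h) f k)
                                  (trans (⊛-distribˡ f g h k) (cong₂ _+_ (⊛-comm f g k) (⊛-comm f h k))))
      }
    ; *-comm = ⊛-comm
    }

  seriesRing : CommutativeRing _ _
  seriesRing = record { isCommutativeRing = series-isCommutativeRing }


module IndexSums where
  open import Data.Nat using (ℕ; zero; suc; _+_; _*_)
  open import Data.Nat.Solver using (module +-*-Solver)
  open +-*-Solver using (solve; _:+_; _:=_)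
  open import Data.Fin using (Fin; zero; suc; punchIn)
  open import Relation.Binary.PropositionalEquality using (_≡_; refl; cong; cong₂; trans)

  sumFinℕ-cong : ∀ {m} {f g : Fin m → ℕ} → (∀ j → f j ≡ g j) → sumFinℕ f ≡ sumFinℕ g
  sumFinℕ-cong {zero} h = refl
  sumFinℕ-cong {suc m} h = cong₂ _+_ (h zero) (sumFinℕ-cong (λ j → h (suc j)))

  sumFinℕ-+ : ∀ {m} (f g : Fin m → ℕ) → sumFinℕ (λ j → f j + g j) ≡ sumFinℕ f + sumFinℕ g
  sumFinℕ-+ {zero} f g = refl
  sumFinℕ-+ {suc m} f g = trans (cong (λ t → f zero + g zero + t) (sumFinℕ-+ (λ j → f (suc j)) (λ j → g (suc j))))
    (solve 4 (λ a b c d → (a :+ b) :+ (c :+ d) := (a :+ c) :+ (b :+ d)) refl (f zero) (g zero) _ _)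

  sumFinℕ-const : ∀ m c → sumFinℕ {m} (λ _ → c) ≡ m * c
  sumFinℕ-const zero c = refl
  sumFinℕ-const (suc m) c = cong (c +_) (sumFinℕ-const m c)

  sumFinℕ-remove : ∀ {n} (p : Fin (suc n)) (C : Fin (suc n) → ℕ) → sumFinℕ C ≡ C p + sumFinℕ (λ c → C (punchIn p c))
  sumFinℕ-remove zero C = refl
  sumFinℕ-remove {suc n} (suc p) C = trans (cong (C zero +_) (sumFinℕ-remove p (λ j → C (suc j))))
    (solve 3 (λ a b r → a :+ (b :+ r) := b :+ (a :+ r)) refl (C zero) (C (suc p)) _)


module SeriesDeterminants where
  open import Data.Nat as ℕ using (ℕ; zero; suc; _∸_; _+_)
  import Data.Nat.Properties as ℕP
  open import Data.Rational as ℚ using (0ℚ; _*_)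
  import Data.Rational.Properties as ℚP
  open import Data.Fin using (Fin; zero; suc; punchIn; toℕ)
  open import Relation.Binary.PropositionalEquality using (_≡_; _≢_; _≗_; refl; cong; sym; trans; subst)
  open import Relation.Binary.PropositionalEquality.Properties using (module ≡-Reasoning)
  open import Relation.Nullary using (yes; no)
  open FiniteSums
  open PowerSeriesRing
  open IndexSums
  module S = Determinant seriesRing
  module Q = Determinant ℚP.+-*-commutativeRing

  sumFinS≡sum : ∀ {n} (f : Fin n → Series) → sumFinS f ≡ S.sum f
  sumFinS≡sum {zero} f = refl
  sumFinS≡sum {suc n} f = cong (f zero ⊕_) (sumFinS≡sum (λ j → f (suc j)))

  negPow≡signed : ∀ k s → negPow k s ≡ S.signed k s
  negPow≡signed zero s = refl
  negPow≡signed (suc k) s = cong ⊖_ (negPow≡signed k s)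

  det≗det′ : ∀ n (M : Fin n → Fin n → Series) → det n M ≗ S.det′ n M
  det≗det′ zero M k = refl
  det≗det′ (suc n) M k = trans (cong (λ t → t k) (sumFinS≡sum terms₀)) (S.sum-cong-≋ {suc n} {terms₀} {S.term M} terms k)
    where
    terms₀ : Fin (suc n) → Series
    terms₀ j = negPow (toℕ j) (M zero j ⊛ det n (S.minor j M))
    terms : ∀ j → negPow (toℕ j) (M zero j ⊛ det n (S.minor j M)) ≗ S.term M j
    terms j = subst (λ t → t ≗ S.term M j) (sym (negPow≡signed (toℕ j) _))
      (S.signed-cong (toℕ j) (⊛-cong {M zero j} (λ _ → refl) (det≗det′ n (S.minor j M))))

  coeff-sum : ∀ {n} (f : Fin n → Series) k → S.sum f k ≡ Q.sum (λ j → f j k)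
  coeff-sum {zero} f k = refl
  coeff-sum {suc n} f k = cong (f zero k ℚ.+_) (coeff-sum (λ j → f (suc j)) k)

  coeff-signed : ∀ t s k → S.signed t s k ≡ Q.signed t (s k)
  coeff-signed zero s k = refl
  coeff-signed (suc t) s k = cong ℚ.-_ (coeff-signed t s k)

  OrderGe : ℕ → Series → Set
  OrderGe L f = ∀ k → k ℕ.< L → f k ≡ 0ℚ

  ⊛-degree : ∀ a b f g → DegLe a f → DegLe b g → DegLe (a + b) (f ⊛ g)
  ⊛-degree a b f g df dg μ a+b<μ = sumTo-zero (suc μ) _ vanishing
    where
    vanishing : ∀ k → k ℕ.< suc μ → f k * g (μ ∸ k) ≡ 0ℚ
    vanishing k _ with a ℕP.<? k
    ... | yes a<k = trans (cong (_* g (μ ∸ k)) (df k a<k)) (ℚP.*-zeroˡ (g (μ ∸ k)))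
    ... | no a≮k = trans (cong (f k *_) (dg (μ ∸ k) (ℕP.m+n≤o⇒m≤o∸n (suc b) b+k<μ))) (ℚP.*-zeroʳ (f k))
      where
      b+k<μ : b + k ℕ.< μ
      b+k<μ = ℕP.≤-<-trans (ℕP.+-monoʳ-≤ b (ℕP.≮⇒≥ a≮k)) (subst (ℕ._< μ) (ℕP.+-comm a b) a+b<μ)

  ⊛-top : ∀ a b f g → DegLe a f → DegLe b g → (f ⊛ g) (a + b) ≡ f a * g b
  ⊛-top a b f g df dg = trans (sumTo-single (suc (a + b)) _ a (ℕP.m≤m+n (suc a) b) others)
                              (cong (λ t → f a * g t) (ℕP.m+n∸m≡n a b))
    where
    others : ∀ k → k ℕ.< suc (a + b) → k ≢ a → f k * g (a + b ∸ k) ≡ 0ℚ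
    others k _ k≢a with a ℕP.<? k
    ... | yes a<k = trans (cong (_* g (a + b ∸ k)) (df k a<k)) (ℚP.*-zeroˡ (g (a + b ∸ k)))
    ... | no a≮k = trans (cong (f k *_) (dg (a + b ∸ k) (ℕP.m+n≤o⇒m≤o∸n (suc b) b+k<a+b))) (ℚP.*-zeroʳ (f k))
      where
      b+k<a+b : b + k ℕ.< a + b
      b+k<a+b = subst (ℕ._< a + b) (ℕP.+-comm k b) (ℕP.+-monoˡ-< b (ℕP.≤∧≢⇒< (ℕP.≮⇒≥ a≮k) k≢a))

  ⊛-order : ∀ a b f g → OrderGe a f → OrderGe b g → OrderGe (a + b) (f ⊛ g)
  ⊛-order a b f g of og μ μ<a+b = sumTo-zero (suc μ) _ vanishing
    where
    vanishing : ∀ k → k ℕ.< suc μ → f k * g (μ ∸ k) ≡ 0ℚ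
    vanishing k k≤μ with k ℕP.<? a
    ... | yes k<a = trans (cong (_* g (μ ∸ k)) (of k k<a)) (ℚP.*-zeroˡ (g (μ ∸ k)))
    ... | no k≮a = trans (cong (f k *_) (og (μ ∸ k) μ-k<b)) (ℚP.*-zeroʳ (f k))
      where
      μ<k+b : μ ℕ.< k + b
      μ<k+b = ℕP.<-≤-trans μ<a+b (ℕP.+-monoˡ-≤ b (ℕP.≮⇒≥ k≮a))
      μ-k<b : μ ∸ k ℕ.< b
      μ-k<b = ℕP.≰⇒> λ b≤ → ℕP.<⇒≱ μ<k+b (subst (k + b ℕ.≤_) (ℕP.m+[n∸m]≡n (ℕP.≤-pred k≤μ)) (ℕP.+-monoʳ-≤ k b≤))

  term-degree : ∀ n (M : S.Matrix (suc n)) (C : Fin (suc n) → ℕ) → (∀ i j → DegLe (C j) (M i j)) →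
    (∀ j → DegLe (sumFinℕ (λ c → C (punchIn j c))) (S.det′ n (S.minor j M))) →
    ∀ j → DegLe (sumFinℕ C) (S.term M j)
  term-degree n M C h minors j k ΣC<k = trans (coeff-signed (toℕ j) _ k)
    (trans (cong (Q.signed (toℕ j)) (⊛-degree (C j) _ _ _ (h zero j) (minors j) k (subst (ℕ._< k) (sumFinℕ-remove j C) ΣC<k)))
           (Q.signed-0 (toℕ j)))

  det-degree : ∀ n (M : S.Matrix n) (C : Fin n → ℕ) → (∀ i j → DegLe (C j) (M i j)) → DegLe (sumFinℕ C) (S.det′ n M)
  det-degree zero M C h (suc k) _ = refl
  det-degree (suc n) M C h k ΣC<k = trans (coeff-sum (S.term M) k) (Q.sum-zero λ j → term-degree n M C h minors j k ΣC<k)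
    where
    minors : ∀ j → DegLe (sumFinℕ (λ c → C (punchIn j c))) (S.det′ n (S.minor j M))
    minors j = det-degree n (S.minor j M) (λ c → C (punchIn j c)) (λ r c → h (suc r) (punchIn j c))

  det-top : ∀ n (M : S.Matrix n) (C : Fin n → ℕ) → (∀ i j → DegLe (C j) (M i j)) →
    S.det′ n M (sumFinℕ C) ≡ Q.det′ n (λ i j → M i j (C j))
  det-top zero M C h = refl
  det-top (suc n) M C h = trans (coeff-sum (S.term M) (sumFinℕ C)) (Q.sum-cong-≋ topTerm)
    where
    rest : Fin (suc n) → ℕ
    rest j = sumFinℕ (λ c → C (punchIn j c))
    topTerm : ∀ j → S.term M j (sumFinℕ C) ≡ Q.term (λ i j → M i j (C j)) j
    topTerm j = trans (coeff-signed (toℕ j) _ _) (cong (Q.signed (toℕ j)) (begin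
      (M zero j ⊛ S.det′ n (S.minor j M)) (sumFinℕ C) ≡⟨ cong (M zero j ⊛ S.det′ n (S.minor j M)) (sumFinℕ-remove j C) ⟩
      (M zero j ⊛ S.det′ n (S.minor j M)) (C j + rest j)
        ≡⟨ ⊛-top (C j) (rest j) _ _ (h zero j) (det-degree n (S.minor j M) (λ c → C (punchIn j c)) (λ r c → h (suc r) (punchIn j c))) ⟩
      M zero j (C j) * S.det′ n (S.minor j M) (rest j)
        ≡⟨ cong (M zero j (C j) *_) (det-top n (S.minor j M) (λ c → C (punchIn j c)) (λ r c → h (suc r) (punchIn j c))) ⟩
      M zero j (C j) * Q.det′ n (Q.minor j (λ i j → M i j (C j))) ∎))
      where open ≡-Reasoning

  det-order : ∀ n (M : S.Matrix n) (L : Fin n → ℕ) → (∀ i j → OrderGe (L j) (M i j)) → OrderGe (sumFinℕ L) (S.det′ n M)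
  det-order zero M L h k ()
  det-order (suc n) M L h k k<ΣL = trans (coeff-sum (S.term M) k) (Q.sum-zero termOrder)
    where
    termOrder : ∀ j → S.term M j k ≡ 0ℚ
    termOrder j = trans (coeff-signed (toℕ j) _ k) (trans (cong (Q.signed (toℕ j))
      (⊛-order (L j) _ _ _ (h zero j) (det-order n (S.minor j M) (λ c → L (punchIn j c)) (λ r c → h (suc r) (punchIn j c)))
               k (subst (k ℕ.<_) (sumFinℕ-remove j L) k<ΣL)))
      (Q.signed-0 (toℕ j)))


module Rationals where
  open import Data.Nat using (_!)
  import Data.Nat.Properties as ℕP
  open import Data.Integer as ℤ using (ℤ; +_)
  import Data.Integer.Properties as ℤP
  open import Data.Integer.GCD using (gcd)
  open import Data.Rational as ℚ using (ℚ; 0ℚ; 1ℚ; _+_; _*_; -_; _-_; _/_; toℚᵘ; 1/_)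
  import Data.Rational.Properties as ℚP
  import Data.Rational.Unnormalised as ℚᵘ
  import Data.Rational.Unnormalised.Properties as ℚᵘP
  open import Relation.Binary.PropositionalEquality using (_≡_; _≢_; cong; cong₂; sym; trans)
  open import Relation.Binary.PropositionalEquality.Properties using (module ≡-Reasoning)
  open import Relation.Nullary.Negation using (contradiction)
  open import Algebra.Properties.Group ℚP.+-0-group using (x∙y⁻¹≈ε⇒x≈y; ⁻¹-involutive)

  ι : ℤ → ℚ
  ι i = i / 1

  toℚᵘ-ι : ∀ i → toℚᵘ (ι i) ℚᵘ.≃ ℚᵘ.mkℚᵘ i 0
  toℚᵘ-ι i = ℚP.toℚᵘ-fromℚᵘ (ℚᵘ.mkℚᵘ i 0)

  ι-+ : ∀ i j → ι i + ι j ≡ ι (i ℤ.+ j)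
  ι-+ i j = ℚP.toℚᵘ-injective (ℚᵘP.≃-trans (ℚP.toℚᵘ-homo-+ (ι i) (ι j))
    (ℚᵘP.≃-trans (ℚᵘP.+-cong (toℚᵘ-ι i) (toℚᵘ-ι j)) (ℚᵘP.≃-trans (ℚᵘ.*≡* unitDenominators) (ℚᵘP.≃-sym (toℚᵘ-ι (i ℤ.+ j))))))
    where
    unitDenominators : (i ℤ.* + 1 ℤ.+ j ℤ.* + 1) ℤ.* + 1 ≡ (i ℤ.+ j) ℤ.* (+ 1 ℤ.* + 1)
    unitDenominators = trans (ℤP.*-identityʳ _) (trans (cong₂ ℤ._+_ (ℤP.*-identityʳ i) (ℤP.*-identityʳ j)) (sym (ℤP.*-identityʳ _)))

  ι-neg : ∀ i → - ι i ≡ ι (ℤ.- i)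
  ι-neg i = ℚP.toℚᵘ-injective (ℚᵘP.≃-trans (ℚP.toℚᵘ-homo‿- (ι i))
    (ℚᵘP.≃-trans (ℚᵘP.-‿cong (toℚᵘ-ι i)) (ℚᵘP.≃-sym (toℚᵘ-ι (ℤ.- i)))))

  ι-- : ∀ i j → ι i - ι j ≡ ι (i ℤ.- j)
  ι-- i j = trans (cong (λ t → ι i + t) (ι-neg j)) (ι-+ i (ℤ.- j))

  ι-injective : ∀ {i j} → ι i ≡ ι j → i ≡ j
  ι-injective {i} {j} e with ℚᵘP.≃-trans (ℚᵘP.≃-sym (toℚᵘ-ι i)) (ℚᵘP.≃-trans (ℚᵘP.≃-reflexive (cong toℚᵘ e)) (toℚᵘ-ι j))
  ... | ℚᵘ.*≡* e′ = trans (sym (ℤP.*-identityʳ i)) (trans e′ (ℤP.*-identityʳ j))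

  sub≡0 : ∀ {x y} → x - y ≡ 0ℚ → x ≡ y
  sub≡0 {x} {y} = x∙y⁻¹≈ε⇒x≈y x y

  add≡0 : ∀ {x y} → x + y ≡ 0ℚ → x ≡ - y
  add≡0 {x} {y} e = sub≡0 (trans (cong (λ t → x + t) (⁻¹-involutive y)) e)

  *-nonZero : ∀ {a b} → a ≢ 0ℚ → b ≢ 0ℚ → a * b ≢ 0ℚ
  *-nonZero {a} {b} a≢0 b≢0 ab≡0 = b≢0 (begin
      b ≡⟨ sym (ℚP.*-identityˡ b) ⟩
      1ℚ * b ≡⟨ cong (_* b) (sym (ℚP.*-inverseˡ a)) ⟩
      (1/ a) * a * b ≡⟨ ℚP.*-assoc (1/ a) a b ⟩
      (1/ a) * (a * b) ≡⟨ cong ((1/ a) *_) ab≡0 ⟩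
      (1/ a) * 0ℚ ≡⟨ ℚP.*-zeroʳ (1/ a) ⟩
      0ℚ ∎)
    where
    open ≡-Reasoning
    instance _ = ℚ.≢-nonZero a≢0

  minusInvFact≢0 : ∀ N → minusInvFact N ≢ 0ℚ
  minusInvFact≢0 N e = contradiction (trans (sym (cong (ℤ._* gcd (+ 1) (+ (N !))) (cong ℚ.↥_ 1/N!≡0))) (ℚP.↥-/ (+ 1) (N !))) (λ ())
    where
    instance _ = ℕP._!≢0 N
    1/N!≡0 : (+ 1 / (N !)) ≡ 0ℚ
    1/N!≡0 = ℚP.neg-injective e


-- Polynomial functions ℚ → ℚ, by Horner's scheme: Poly d a f says that f
-- is a polynomial function of degree ≤ d whose coefficient of x^d is a.
module PolynomialFunctions where
  open import Data.Nat as ℕ using (ℕ; zero; suc)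
  open import Data.Rational as ℚ using (ℚ; 0ℚ; _+_; _*_; _-_)
  import Data.Rational.Properties as ℚP
  open import Data.Rational.Solver using (module +-*-Solver)
  open +-*-Solver using (solve; _:+_; _:*_; _:-_; _:=_)
  open import Data.Fin using (Fin; zero; suc)
  open import Data.Fin.Properties using (suc-injective)
  open import Data.Product using (Σ; _×_; _,_)
  open import Function using (_∘_)
  open import Relation.Binary.PropositionalEquality using (_≡_; _≢_; refl; cong; cong₂; sym; trans)
  open import Relation.Binary.PropositionalEquality.Properties using (module ≡-Reasoning)
  open import Relation.Nullary using (yes; no)
  open import Relation.Nullary.Negation using (contradiction)
  open Rationals using (sub≡0; *-nonZero)

  data Poly : ℕ → ℚ → (ℚ → ℚ) → Set where
    constant : ∀ {a f} → (∀ x → f x ≡ a) → Poly 0 a f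
    horner : ∀ {d a f} (g : ℚ → ℚ) c → Poly d a g → (∀ x → f x ≡ x * g x + c) → Poly (suc d) a f

  poly-zero : ∀ d → Poly d 0ℚ (λ _ → 0ℚ)
  poly-zero zero = constant (λ _ → refl)
  poly-zero (suc d) = horner (λ _ → 0ℚ) 0ℚ (poly-zero d) (λ x → sym (trans (ℚP.+-identityʳ (x * 0ℚ)) (ℚP.*-zeroʳ x)))

  poly-raise : ∀ {d a f} → Poly d a f → Poly (suc d) 0ℚ f
  poly-raise {a = a} (constant h) = horner (λ _ → 0ℚ) a (constant (λ _ → refl))
    (λ x → trans (h x) (sym (trans (cong (_+ a) (ℚP.*-zeroʳ x)) (ℚP.+-identityˡ a))))
  poly-raise (horner g c p h) = horner g c (poly-raise p) h

  poly-raiseBy : ∀ {d a f} → Poly d a f → ∀ k → Poly (suc (k ℕ.+ d)) 0ℚ f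
  poly-raiseBy p zero = poly-raise p
  poly-raiseBy p (suc k) = poly-raise (poly-raiseBy p k)

  poly-scale : ∀ {d a f} s → Poly d a f → Poly d (s * a) (λ x → s * f x)
  poly-scale s (constant h) = constant (λ x → cong (s *_) (h x))
  poly-scale s (horner g c p h) = horner (λ x → s * g x) (s * c) (poly-scale s p)
    (λ x → trans (cong (s *_) (h x)) (solve 4 (λ s x g c → s :* ((x :* g) :+ c) := (x :* (s :* g)) :+ (s :* c)) refl s x (g x) c))

  poly-add : ∀ {d a b f g} → Poly d a f → Poly d b g → Poly d (a + b) (λ x → f x + g x)
  poly-add (constant h₁) (constant h₂) = constant (λ x → cong₂ _+_ (h₁ x) (h₂ x))
  poly-add (horner g₁ c₁ p₁ h₁) (horner g₂ c₂ p₂ h₂) = horner (λ x → g₁ x + g₂ x) (c₁ + c₂) (poly-add p₁ p₂)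
    (λ x → trans (cong₂ _+_ (h₁ x) (h₂ x))
      (solve 5 (λ x a b c d → ((x :* a) :+ c) :+ ((x :* b) :+ d) := (x :* (a :+ b)) :+ (c :+ d)) refl x (g₁ x) (g₂ x) c₁ c₂))

  poly-addConstant : ∀ {d a f} k → Poly (suc d) a f → Poly (suc d) a (λ x → f x + k)
  poly-addConstant k (horner g c p h) = horner g (c + k) p (λ x → trans (cong (_+ k) (h x)) (ℚP.+-assoc (x * g x) c k))

  poly-*-linear : ∀ {d a f} c → Poly d a f → Poly (suc d) a (λ x → f x * (x + c))
  poly-*-linear {a = a} c (constant h) = horner (λ _ → a) (a * c) (constant (λ _ → refl))
    (λ x → trans (cong (_* (x + c)) (h x)) (solve 3 (λ a x c → a :* (x :+ c) := (x :* a) :+ (a :* c)) refl a x c))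
  poly-*-linear c (horner g c′ p h) = horner (λ x → (g x * (x + c)) + c′) (c′ * c) (poly-addConstant c′ (poly-*-linear c p))
    (λ x → trans (cong (_* (x + c)) (h x))
      (solve 4 (λ x g c c′ → ((x :* g) :+ c′) :* (x :+ c) := (x :* ((g :* (x :+ c)) :+ c′)) :+ (c′ :* c)) refl x (g x) c c′))

  poly-factor : ∀ {d a f} → Poly (suc d) a f → ∀ r → Σ (ℚ → ℚ) (λ h → Poly d a h × (∀ x → f x ≡ (x - r) * h x + f r))
  poly-factor {zero} {a} {f} (horner g c (constant g≡a) h) r = (λ _ → a) , constant (λ _ → refl) , λ x → begin
      f x ≡⟨ h x ⟩
      x * g x + c ≡⟨ cong (λ t → x * t + c) (g≡a x) ⟩
      x * a + c ≡⟨ solve 4 (λ x r a c → (x :* a) :+ c := ((x :- r) :* a) :+ ((r :* a) :+ c)) refl x r a c ⟩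
      (x - r) * a + (r * a + c) ≡⟨ cong (λ t → (x - r) * a + (r * t + c)) (sym (g≡a r)) ⟩
      (x - r) * a + (r * g r + c) ≡⟨ cong ((x - r) * a +_) (sym (h r)) ⟩
      (x - r) * a + f r ∎
    where open ≡-Reasoning
  poly-factor {suc d} {a} {f} (horner g c p h) r with poly-factor p r
  ... | q , pq , g≡ = (λ x → x * q x + g r) , horner q (g r) pq (λ _ → refl) , λ x → begin
      f x ≡⟨ h x ⟩
      x * g x + c ≡⟨ cong (λ t → x * t + c) (g≡ x) ⟩
      x * ((x - r) * q x + g r) + c
        ≡⟨ solve 5 (λ x r h g c → (x :* (((x :- r) :* h) :+ g)) :+ c := ((x :- r) :* ((x :* h) :+ g)) :+ ((r :* g) :+ c))
                   refl x r (q x) (g r) c ⟩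
      (x - r) * (x * q x + g r) + (r * g r + c) ≡⟨ cong ((x - r) * (x * q x + g r) +_) (sym (h r)) ⟩
      (x - r) * (x * q x + g r) + f r ∎
    where open ≡-Reasoning

  poly-factorRoot : ∀ {d a f} → Poly (suc d) a f → ∀ r → f r ≡ 0ℚ → Σ (ℚ → ℚ) (λ h → Poly d a h × (∀ x → f x ≡ (x - r) * h x))
  poly-factorRoot p r fr≡0 with poly-factor p r
  ... | h , ph , f≡ = h , ph , λ x → trans (f≡ x) (trans (cong ((x - r) * h x +_) fr≡0) (ℚP.+-identityʳ _))

  poly-nonvanishing : ∀ d {a f} (roots : Fin d → ℚ) → Poly d a f → a ≢ 0ℚ → (∀ i j → i ≢ j → roots i ≢ roots j) →
    (∀ i → f (roots i) ≡ 0ℚ) → ∀ x → (∀ i → x ≢ roots i) → f x ≢ 0ℚ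
  poly-nonvanishing zero roots (constant h) a≢0 _ _ x _ fx≡0 = a≢0 (trans (sym (h x)) fx≡0)
  poly-nonvanishing (suc d) {a} {f} roots p a≢0 distinct vanish x x∉ with poly-factorRoot p (roots zero) (vanish zero)
  ... | h , ph , f≡ = λ fx≡0 → *-nonZero (x∉ zero ∘ sub≡0) hx≢0 (trans (sym (f≡ x)) fx≡0)
    where
    -- the cofactor h vanishes at the remaining roots, which differ from roots zero
    hVanishes : ∀ i → h (roots (suc i)) ≡ 0ℚ
    hVanishes i with ℚP._≟_ (h (roots (suc i))) 0ℚ
    ... | yes h≡0 = h≡0
    ... | no h≢0 = contradiction (trans (sym (f≡ (roots (suc i)))) (vanish (suc i)))
                     (*-nonZero (distinct (suc i) zero (λ ()) ∘ sub≡0) h≢0)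
    hx≢0 : h x ≢ 0ℚ
    hx≢0 = poly-nonvanishing d (roots ∘ suc) ph a≢0 (λ i j i≢j → distinct (suc i) (suc j) (i≢j ∘ suc-injective)) hVanishes x (x∉ ∘ suc)


module Pochhammer where
  open import Data.Nat as ℕ using (zero; suc)
  import Data.Nat.Properties as ℕP
  open import Data.Integer using (+_)
  open import Data.Rational using (0ℚ; 1ℚ; _+_; _*_; -_; _/_)
  import Data.Rational.Properties as ℚP
  open import Relation.Binary.PropositionalEquality using (_≡_; _≢_; refl; cong; cong₂; sym; trans)
  open import Relation.Binary.PropositionalEquality.Properties using (module ≡-Reasoning)
  open Rationals
  open PolynomialFunctions

  poch-poly : ∀ r → Poly r 1ℚ (λ x → poch x r)
  poch-poly zero = constant (λ _ → refl)
  poch-poly (suc r) = poly-*-linear (+ r / 1) (poch-poly r)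

  poch-0 : ∀ r → poch 0ℚ (suc r) ≡ 0ℚ
  poch-0 zero = ℚP.*-zeroʳ 1ℚ
  poch-0 (suc r) = trans (cong (_* (0ℚ + ι (+ suc r))) (poch-0 r)) (ℚP.*-zeroˡ (0ℚ + ι (+ suc r)))

  poch-+ : ∀ α p q → poch α (p ℕ.+ q) ≡ poch α p * poch (α + ι (+ p)) q
  poch-+ α p zero = trans (cong (poch α) (ℕP.+-identityʳ p)) (sym (ℚP.*-identityʳ _))
  poch-+ α p (suc q) = begin
    poch α (p ℕ.+ suc q) ≡⟨ cong (poch α) (ℕP.+-suc p q) ⟩
    poch α (p ℕ.+ q) * (α + ι (+ (p ℕ.+ q)))
      ≡⟨ cong₂ _*_ (poch-+ α p q) (trans (cong (λ u → α + u) (sym (ι-+ (+ p) (+ q)))) (sym (ℚP.+-assoc α _ _))) ⟩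
    poch α p * poch (α + ι (+ p)) q * ((α + ι (+ p)) + ι (+ q)) ≡⟨ ℚP.*-assoc (poch α p) _ _ ⟩
    poch α p * poch (α + ι (+ p)) (suc q) ∎
    where open ≡-Reasoning

  poch-nonZero : ∀ α → (∀ k → α ≢ - (+ k / 1)) → ∀ t → poch α t ≢ 0ℚ
  poch-nonZero α α∉ zero = λ ()
  poch-nonZero α α∉ (suc t) = *-nonZero (poch-nonZero α α∉ t) (λ e → α∉ t (add≡0 e))


-- For μ ≥ N the coefficient of
-- z^μ in Q₀·φ_α is (α)_{μ-N}·A(α+μ-N), where A(x) = Σ_{k≤N} a_k (x)_{N-k}
-- is a polynomial of degree N with top coefficient a_0 and A(0) = a_N.
-- The vanishing conditions on Q₀ make α_j + t a root of A for the n_j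
-- values t = n-n_j+1, …, n; these N roots are distinct and nonzero, so
-- A(0) ≠ 0.
module LeadingCoefficient where
  open import Data.Nat as ℕ using (ℕ; zero; suc; _∸_)
  import Data.Nat.Properties as ℕP
  open import Data.Integer as ℤ using (ℤ; +_)
  import Data.Integer.Properties as ℤP
  open import Data.Rational as ℚ using (ℚ; 0ℚ; 1ℚ; _+_; _*_; -_; _-_)
  import Data.Rational.Properties as ℚP
  open import Data.Rational.Solver using (module +-*-Solver)
  open +-*-Solver using (solve; _:+_; _:*_; _:-_; _:=_)
  open import Data.Fin as F using (Fin; zero; suc; splitAt; _↑ˡ_; _↑ʳ_)
  import Data.Fin.Properties as FP
  open import Data.Sum using (inj₁; inj₂)
  open import Relation.Binary.PropositionalEquality using (_≡_; _≢_; refl; cong; sym; trans; subst)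
  open import Relation.Binary.PropositionalEquality.Properties using (module ≡-Reasoning)
  open import Relation.Nullary using (yes; no)
  open import Relation.Nullary.Negation using (contradiction)
  open import Algebra.Properties.Group ℚP.+-0-group using (∙-cancelˡ)
  open Rationals
  open PolynomialFunctions
  open Pochhammer
  open FiniteSums using (sumTo-single; sumTo-*ˡ; sumTo-cong; sumTo-prefix)

  module _ (Q₀ : Series) (N : ℕ) where
    A : ℚ → ℚ
    A x = sumTo (suc N) (λ k → Q₀ k * poch x (N ∸ k))

    -- only the term k = 0 reaches degree N
    private
      top : ℕ → ℚ
      top zero = 0ℚ
      top (suc K) = Q₀ 0 * 1ℚ

      termTop : ℕ → ℚ
      termTop zero = Q₀ 0 * 1ℚ
      termTop (suc _) = 0ℚ

      term-poly : ∀ K → suc K ℕ.≤ suc N → Poly N (termTop K) (λ x → Q₀ K * poch x (N ∸ K))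
      term-poly zero _ = poly-scale (Q₀ 0) (poch-poly N)
      term-poly (suc K) K<N = subst (λ d → Poly d 0ℚ (λ x → Q₀ (suc K) * poch x (N ∸ suc K))) (ℕP.m+[n∸m]≡n (ℕP.≤-pred K<N))
                                    (poly-raiseBy (poly-scale (Q₀ (suc K)) (poch-poly (N ∸ suc K))) K)

      top-step : ∀ K → top K + termTop K ≡ top (suc K)
      top-step zero = ℚP.+-identityˡ _
      top-step (suc K) = ℚP.+-identityʳ _

      partial-poly : ∀ K → K ℕ.≤ suc N → Poly N (top K) (λ x → sumTo K (λ k → Q₀ k * poch x (N ∸ k)))
      partial-poly zero _ = poly-zero N
      partial-poly (suc K) K<N = subst (λ a → Poly N a (λ x → sumTo (suc K) (λ k → Q₀ k * poch x (N ∸ k)))) (top-step K) (poly-add (partial-poly K (ℕP.<⇒≤ K<N)) (term-poly K K<N))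

    A-poly : Poly N (Q₀ 0) A
    A-poly = subst (λ a → Poly N a A) (ℚP.*-identityʳ (Q₀ 0)) (partial-poly (suc N) ℕP.≤-refl)

    A-at-0 : A 0ℚ ≡ Q₀ N
    A-at-0 = trans (sumTo-single (suc N) _ N (ℕP.n<1+n N) others) (trans (cong (λ t → Q₀ N * poch 0ℚ t) (ℕP.n∸n≡0 N)) (ℚP.*-identityʳ (Q₀ N)))
      where
      others : ∀ k → k ℕ.< suc N → k ≢ N → Q₀ k * poch 0ℚ (N ∸ k) ≡ 0ℚ
      others k k≤N k≢N = trans (cong (λ t → Q₀ k * poch 0ℚ t) (ℕP.+-∸-assoc 1 k<N)) (trans (cong (Q₀ k *_) (poch-0 (N ∸ suc k))) (ℚP.*-zeroʳ (Q₀ k)))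
        where
        k<N : k ℕ.< N
        k<N = ℕP.≤∧≢⇒< (ℕP.≤-pred k≤N) k≢N

    ⊛-phi : ∀ α μ → N ℕ.≤ μ → DegLe N Q₀ → (Q₀ ⊛ phi α) μ ≡ poch α (μ ∸ N) * A (α + ι (+ (μ ∸ N)))
    ⊛-phi α μ N≤μ degQ₀ = begin
      sumTo (suc μ) (λ k → Q₀ k * poch α (μ ∸ k))
        ≡⟨ cong (λ t → sumTo t (λ k → Q₀ k * poch α (μ ∸ k))) (sym (ℕP.m+[n∸m]≡n (ℕ.s≤s N≤μ))) ⟩
      sumTo (suc N ℕ.+ (suc μ ∸ suc N)) (λ k → Q₀ k * poch α (μ ∸ k))
        ≡⟨ sumTo-prefix (suc N) (suc μ ∸ suc N) _ (λ k N<k → trans (cong (_* poch α (μ ∸ k)) (degQ₀ k N<k)) (ℚP.*-zeroˡ (poch α (μ ∸ k)))) ⟩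
      sumTo (suc N) (λ k → Q₀ k * poch α (μ ∸ k))
        ≡⟨ sumTo-cong (suc N) (λ k k≤N → trans (cong (λ t → Q₀ k * poch α t) (split k (ℕP.≤-pred k≤N)))
              (trans (cong (Q₀ k *_) (poch-+ α (μ ∸ N) (N ∸ k)))
                (solve 3 (λ q a b → q :* (a :* b) := a :* (q :* b)) refl (Q₀ k) (poch α (μ ∸ N)) (poch (α + ι (+ (μ ∸ N))) (N ∸ k))))) ⟩
      sumTo (suc N) (λ k → poch α (μ ∸ N) * (Q₀ k * poch (α + ι (+ (μ ∸ N))) (N ∸ k)))
        ≡⟨ sym (sumTo-*ˡ (suc N) (poch α (μ ∸ N)) _) ⟩
      poch α (μ ∸ N) * A (α + ι (+ (μ ∸ N))) ∎
      where
      open ≡-Reasoning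
      split : ∀ k → k ℕ.≤ N → μ ∸ k ≡ (μ ∸ N) ℕ.+ (N ∸ k)
      split k k≤N = trans (cong (_∸ k) (sym recompose)) (ℕP.m+n∸n≡m ((μ ∸ N) ℕ.+ (N ∸ k)) k)
        where
        recompose : (μ ∸ N) ℕ.+ (N ∸ k) ℕ.+ k ≡ μ
        recompose = trans (ℕP.+-assoc (μ ∸ N) (N ∸ k) k) (trans (cong ((μ ∸ N) ℕ.+_) (ℕP.m∸n+n≡m k≤N)) (ℕP.m∸n+n≡m N≤μ))

  -- Fin (n_1 + ⋯ + n_m) enumerates the pairs (j, o) with o < n_j.
  block : ∀ {m} (ns : Fin m → ℕ) → Fin (sumFinℕ ns) → Fin m
  block {suc m} ns x with splitAt (ns zero) x
  ... | inj₁ _ = zero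
  ... | inj₂ y = suc (block (λ j → ns (suc j)) y)

  offset : ∀ {m} (ns : Fin m → ℕ) → Fin (sumFinℕ ns) → ℕ
  offset {suc m} ns x with splitAt (ns zero) x
  ... | inj₁ i = F.toℕ i
  ... | inj₂ y = offset (λ j → ns (suc j)) y

  offset< : ∀ {m} (ns : Fin m → ℕ) x → offset ns x ℕ.< ns (block ns x)
  offset< {suc m} ns x with splitAt (ns zero) x
  ... | inj₁ i = FP.toℕ<n i
  ... | inj₂ y = offset< (λ j → ns (suc j)) y

  block-offset-injective : ∀ {m} (ns : Fin m → ℕ) x y → block ns x ≡ block ns y → offset ns x ≡ offset ns y → x ≡ y
  block-offset-injective {suc m} ns x y eb eo with splitAt (ns zero) x in ex | splitAt (ns zero) y in ey
  ... | inj₁ i | inj₁ i′ = trans (sym (FP.splitAt⁻¹-↑ˡ ex)) (trans (cong (_↑ˡ _) (FP.toℕ-injective eo)) (FP.splitAt⁻¹-↑ˡ ey))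
  ... | inj₁ _ | inj₂ _ = contradiction eb (λ ())
  ... | inj₂ _ | inj₁ _ = contradiction eb (λ ())
  ... | inj₂ x′ | inj₂ y′ = trans (sym (FP.splitAt⁻¹-↑ʳ ex))
      (trans (cong (ns zero ↑ʳ_) (block-offset-injective (λ j → ns (suc j)) x′ y′ (FP.suc-injective eb) eo)) (FP.splitAt⁻¹-↑ʳ ey))

  module _ (m : ℕ) (α : Fin m → ℚ) (α∉ : ∀ i (k : ℕ) → α i ≢ - (+ k ℚ./ 1))
           (αdistinct : ∀ i j → i ≢ j → ∀ (z : ℤ) → α i - α j ≢ z ℚ./ 1)
           (ns : Fin m → ℕ) (n : ℕ) (ns≤n : ∀ i → ns i ℕ.≤ n)
           (Q₀ : Series) (degQ₀ : DegLe (sumFinℕ ns) Q₀)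
           (vanish₀ : ∀ j μ → sumFinℕ ns ℕ.+ n ∸ ns j ℕ.+ 1 ℕ.≤ μ → μ ℕ.≤ sumFinℕ ns ℕ.+ n → (Q₀ ⊛ phi (α j)) μ ≡ 0ℚ) where
    private
      N : ℕ
      N = sumFinℕ ns

      shift : Fin N → ℕ
      shift x = (n ∸ ns (block ns x)) ℕ.+ suc (offset ns x)

      root : Fin N → ℚ
      root x = α (block ns x) + ι (+ shift x)

      root-vanishes : ∀ x → A Q₀ N (root x) ≡ 0ℚ
      root-vanishes x with ℚP._≟_ (A Q₀ N (root x)) 0ℚ
      ... | yes A≡0 = A≡0
      ... | no A≢0 = contradiction product≡0 (*-nonZero (poch-nonZero (α j) (α∉ j) t) A≢0)
        where
        j : Fin m
        j = block ns x
        t : ℕ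
        t = shift x
        t≤n : t ℕ.≤ n
        t≤n = subst (t ℕ.≤_) (ℕP.m∸n+n≡m (ns≤n j)) (ℕP.+-monoʳ-≤ (n ∸ ns j) (offset< ns x))
        above : N ℕ.+ n ∸ ns j ℕ.+ 1 ℕ.≤ N ℕ.+ t
        above = subst (λ u → u ℕ.+ 1 ℕ.≤ N ℕ.+ t) (sym (ℕP.+-∸-assoc N (ns≤n j)))
                  (subst (N ℕ.+ (n ∸ ns j) ℕ.+ 1 ℕ.≤_) (ℕP.+-assoc N (n ∸ ns j) (suc (offset ns x)))
                     (ℕP.+-monoʳ-≤ (N ℕ.+ (n ∸ ns j)) (ℕ.s≤s ℕ.z≤n)))
        product≡0 : poch (α j) t * A Q₀ N (root x) ≡ 0ℚ
        product≡0 = trans (sym (trans (⊛-phi Q₀ N (α j) (N ℕ.+ t) (ℕP.m≤m+n N t) degQ₀)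
                              (cong (λ u → poch (α j) u * A Q₀ N (α j + ι (+ u))) (ℕP.m+n∸m≡n N t))))
                          (vanish₀ j (N ℕ.+ t) above (ℕP.+-monoʳ-≤ N t≤n))

      root-nonZero : ∀ x → 0ℚ ≢ root x
      root-nonZero x 0≡ = α∉ (block ns x) (shift x) (add≡0 (sym 0≡))

      roots-distinct : ∀ x y → x ≢ y → root x ≢ root y
      roots-distinct x y x≢y rx≡ry with block ns x F.≟ block ns y
      ... | yes eb = x≢y (block-offset-injective ns x y eb eo)
        where
        shifts : ι (+ shift x) ≡ ι (+ ((n ∸ ns (block ns y)) ℕ.+ suc (offset ns y)))
        shifts = ∙-cancelˡ (α (block ns x)) _ _ (trans rx≡ry (cong (λ j → α j + ι (+ ((n ∸ ns (block ns y)) ℕ.+ suc (offset ns y)))) (sym eb)))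
        eo : offset ns x ≡ offset ns y
        eo = ℕP.suc-injective (ℕP.+-cancelˡ-≡ (n ∸ ns (block ns x)) _ _
               (trans (ℤP.+-injective (ι-injective shifts)) (cong (λ j → (n ∸ ns j) ℕ.+ suc (offset ns y)) (sym eb))))
      ... | no ¬eb = αdistinct (block ns x) (block ns y) ¬eb (+ shift y ℤ.- + shift x) (begin
        α jx - α jy ≡⟨ solve 4 (λ a b c d → a :- c := ((a :+ b) :- c) :- b) refl (α jx) (ι (+ shift x)) (α jy) (ι (+ shift y)) ⟩
        (root x - α jy) - ι (+ shift x) ≡⟨ cong (λ u → (u - α jy) - ι (+ shift x)) rx≡ry ⟩
        (root y - α jy) - ι (+ shift x) ≡⟨ cong (_- ι (+ shift x)) (solve 2 (λ c d → (c :+ d) :- c := d) refl (α jy) (ι (+ shift y))) ⟩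
        ι (+ shift y) - ι (+ shift x) ≡⟨ ι-- (+ shift y) (+ shift x) ⟩
        ι (+ shift y ℤ.- + shift x) ∎)
        where
        open ≡-Reasoning
        jx : Fin m
        jx = block ns x
        jy : Fin m
        jy = block ns y

    leadingCoefficient≢0 : Q₀ 0 ≢ 0ℚ → Q₀ N ≢ 0ℚ
    leadingCoefficient≢0 a₀≢0 aN≡0 =
      poly-nonvanishing N root (A-poly Q₀ N) a₀≢0 roots-distinct root-vanishes 0ℚ root-nonZero (trans (A-at-0 Q₀ N) aN≡0)


module Elementary where
  open import Data.Nat as ℕ using (_≤_; _<_)
  import Data.Nat.Properties as ℕP
  open import Data.Rational using (0ℚ)
  open import Data.Bool using (true; false; T)
  open import Data.Unit using (tt)
  open import Data.Fin as F using (Fin)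
  open import Relation.Binary.PropositionalEquality using (_≡_; _≢_; refl; sym; subst)
  open import Relation.Nullary using (yes; no)
  open import Relation.Nullary.Negation using (contradiction)

  trunc-above : ∀ d f k → d < k → trunc d f k ≡ 0ℚ
  trunc-above d f k d<k with k ℕ.≤ᵇ d in eq
  ... | true = contradiction (ℕP.≤ᵇ⇒≤ k d (subst T (sym eq) tt)) (ℕP.<⇒≱ d<k)
  ... | false = refl

  trunc-below : ∀ d f k → k ≤ d → trunc d f k ≡ f k
  trunc-below d f k k≤d with k ℕ.≤ᵇ d in eq
  ... | true = refl
  ... | false = contradiction (subst T eq (ℕP.≤⇒≤ᵇ k≤d)) (λ ())

  trunc-degree : ∀ d f → DegLe d (trunc d f)
  trunc-degree = trunc-above

  degree-mono : ∀ {d d′} f → d ≤ d′ → DegLe d f → DegLe d′ f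
  degree-mono f d≤d′ h k d′<k = h k (ℕP.≤-<-trans d≤d′ d′<k)

  monomial-off : ∀ c e k → k ≢ e → monomial c e k ≡ 0ℚ
  monomial-off c e k k≢e with k ℕ.≡ᵇ e in eq
  ... | true = contradiction (ℕP.≡ᵇ⇒≡ k e (subst T (sym eq) tt)) k≢e
  ... | false = refl

  monomial-at : ∀ c e → monomial c e e ≡ c
  monomial-at c e with e ℕ.≡ᵇ e in eq
  ... | true = refl
  ... | false = contradiction (subst T eq (ℕP.≡⇒≡ᵇ e e refl)) (λ ())

  δ-diagonal : ∀ {m} (i : Fin m) → δ i i ≡ 1
  δ-diagonal i with i F.≟ i
  ... | yes _ = refl
  ... | no i≢i = contradiction refl i≢i

  δ-off : ∀ {m} (i j : Fin m) → i ≢ j → δ i j ≡ 0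
  δ-off i j i≢j with i F.≟ j
  ... | yes e = contradiction e i≢j
  ... | no _ = refl

  δ≤1 : ∀ {m} (i j : Fin m) → δ i j ≤ 1
  δ≤1 i j with i F.≟ j
  ... | yes _ = ℕP.≤-refl
  ... | no _ = ℕ.z≤n


-- Column 0 of Ω has degree ≤ N and
-- column j has degree ≤ N+n-n_j+1, so Ω has degree ≤ m(N+n)+m, and its
-- coefficient there is the determinant of a block-triangular matrix of top
-- coefficients, a_N·α_1⋯α_m.  Subtracting φ_j·(column 0) from column j
-- does not change Ω and, by the vanishing conditions, leaves entries of
-- order ≥ N+n+1 in the columns j ≥ 1; so Ω has order ≥ m(N+n)+m as well.
module OmegaDeterminant where
  open import Data.Nat as ℕ using (ℕ; zero; suc; _+_; _*_; _∸_; _≤_; _<_)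
  import Data.Nat.Properties as ℕP
  open import Data.Rational as ℚ using (ℚ; 0ℚ)
  import Data.Rational.Properties as ℚP
  open import Data.Fin using (Fin; zero; suc)
  open import Function using (_∘_)
  open import Relation.Binary.PropositionalEquality using (_≡_; _≢_; refl; cong; cong₂; sym; trans; subst)
  open import Relation.Binary.PropositionalEquality.Properties using (module ≡-Reasoning)
  open import Relation.Binary.Definitions using (Tri; tri<; tri≈; tri>)
  open import Relation.Nullary using (yes; no)
  open IndexSums
  open PowerSeriesRing using (⊛-comm)
  open SeriesDeterminants
  open Elementary

  module _
    (m : ℕ) (α : Fin m → ℚ) (ns : Fin m → ℕ) (n : ℕ) (ns≤n : ∀ i → ns i ≤ n)
    (Q₀ : Series) (degQ₀ : DegLe (sumFinℕ ns) Q₀)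
    (vanish₀ : ∀ j μ → sumFinℕ ns + n ∸ ns j + 1 ≤ μ → μ ≤ sumFinℕ ns + n → (Q₀ ⊛ phi (α j)) μ ≡ 0ℚ)
    (Q : Fin m → Series) (degQ : ∀ i → DegLe (sumFinℕ ns) (Q i))
    (vanish : ∀ i j μ → sumFinℕ ns + n ∸ ns j + 1 + δ i j ≤ μ → μ ≤ sumFinℕ ns + n + δ i j → (Q i ⊛ phi (α j)) μ ≡ 0ℚ)
    (topQ : ∀ i → (Q i ⊛ phi (α i)) (sumFinℕ ns + n ∸ ns i + 1) ≡ α i)
    where

    N : ℕ
    N = sumFinℕ ns
    Ω : S.Matrix (suc m)
    Ω = OmegaMatrix m N n ns α Q₀ Q
    T : ℕ
    T = m * (N + n) + m

    d : Fin m → ℕ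
    d j = N + n ∸ ns j

    colDegree : Fin (suc m) → ℕ
    colDegree zero = N
    colDegree (suc j) = d j + 1

    colOrder : Fin (suc m) → ℕ
    colOrder zero = 0
    colOrder (suc j) = N + n + 1

    m·[N+n+1]≡T : m * (N + n + 1) ≡ T
    m·[N+n+1]≡T = trans (ℕP.*-distribˡ-+ m (N + n) 1) (cong (m * (N + n) +_) (ℕP.*-identityʳ m))

    Σ-colOrder : sumFinℕ colOrder ≡ T
    Σ-colOrder = trans (sumFinℕ-const m (N + n + 1)) m·[N+n+1]≡T

    -- since n_j ≤ n ≤ N + n, column j and its weight n_j add up to N + n + 1
    Σ-colDegree : sumFinℕ colDegree ≡ T
    Σ-colDegree = trans (ℕP.+-comm N _) (trans (sym (sumFinℕ-+ (λ j → d j + 1) ns))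
                    (trans (sumFinℕ-cong complement) Σ-colOrder))
      where
      complement : ∀ j → d j + 1 + ns j ≡ N + n + 1
      complement j = begin
        d j + 1 + ns j ≡⟨ ℕP.+-assoc (d j) 1 (ns j) ⟩
        d j + (1 + ns j) ≡⟨ cong (d j +_) (ℕP.+-comm 1 (ns j)) ⟩
        d j + (ns j + 1) ≡⟨ ℕP.+-assoc (d j) (ns j) 1 ⟨
        d j + ns j + 1 ≡⟨ cong (_+ 1) (ℕP.m∸n+n≡m (ℕP.≤-trans (ns≤n j) (ℕP.m≤n+m n N))) ⟩
        N + n + 1 ∎
        where open ≡-Reasoning

    Ω-degree : ∀ i j → DegLe (colDegree j) (Ω i j)
    Ω-degree zero zero = degQ₀
    Ω-degree zero (suc j) = degree-mono _ (ℕP.m≤m+n (d j) 1) (trunc-degree (d j) (Q₀ ⊛ phi (α j)))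
    Ω-degree (suc i) zero = degQ i
    Ω-degree (suc i) (suc j) = degree-mono _ (ℕP.+-monoʳ-≤ (d j) (δ≤1 i j)) (trunc-degree (d j + δ i j) (Q i ⊛ phi (α j)))

    top : Fin (suc m) → Fin (suc m) → ℚ
    top i j = Ω i j (colDegree j)

    d<d+1 : ∀ j → d j < d j + 1
    d<d+1 j = ℕP.m<m+n (d j) (ℕ.s≤s ℕ.z≤n)

    top-firstRow : ∀ j → top zero (suc j) ≡ 0ℚ
    top-firstRow j = trunc-above (d j) (Q₀ ⊛ phi (α j)) (d j + 1) (d<d+1 j)

    top-offDiagonal : ∀ i j → i ≢ j → top (suc i) (suc j) ≡ 0ℚ
    top-offDiagonal i j i≢j = trunc-above (d j + δ i j) (Q i ⊛ phi (α j)) (d j + 1)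
      (subst (λ t → d j + t < d j + 1) (sym (δ-off i j i≢j)) (subst (_< d j + 1) (sym (ℕP.+-identityʳ (d j))) (d<d+1 j)))

    top-diagonal : ∀ i → top (suc i) (suc i) ≡ α i
    top-diagonal i = trans (trunc-below (d i + δ i i) (Q i ⊛ phi (α i)) (d i + 1) (subst (λ t → d i + 1 ≤ d i + t) (sym (δ-diagonal i)) ℕP.≤-refl)) (topQ i)

    product≡prodFinℚ : ∀ {k} (f g : Fin k → ℚ) → (∀ i → f i ≡ g i) → Q.product f ≡ prodFinℚ g
    product≡prodFinℚ {zero} f g h = refl
    product≡prodFinℚ {suc k} f g h = cong₂ ℚ._*_ (h zero) (product≡prodFinℚ (λ j → f (suc j)) (λ j → g (suc j)) (λ j → h (suc j)))

    det-top-Ω : Q.det′ (suc m) top ≡ Q₀ N ℚ.* prodFinℚ α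
    det-top-Ω = trans (Q.det-firstRow m top top-firstRow)
      (cong (Q₀ N ℚ.*_) (trans (Q.det-diagonal m (Q.minor zero top) top-offDiagonal) (product≡prodFinℚ _ α top-diagonal)))

    reduced : S.Matrix (suc m)
    reduced i zero = Ω i zero
    reduced i (suc j) = Ω i (suc j) ⊕ (⊖ (phi (α j) ⊛ Ω i zero))

    det-reduced : ∀ k → S.det′ (suc m) reduced k ≡ S.det′ (suc m) Ω k
    det-reduced = S.det-columnOperations m Ω reduced (λ j → phi (α j)) (λ i k → refl) (λ i j k → refl)

    truncationError-order : ∀ e c f → (∀ k → e < k → k ≤ c → f k ≡ 0ℚ) → OrderGe (suc c) (trunc e f ⊕ (⊖ f))
    truncationError-order e c f vanishes k k≤c with k ℕP.≤? e
    ... | yes k≤e = trans (cong (ℚ._+ ℚ.- f k) (trunc-below e f k k≤e)) (ℚP.+-inverseʳ (f k))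
    ... | no k≰e = trans (cong₂ (λ a b → a ℚ.+ ℚ.- b) (trunc-above e f k e<k) (vanishes k e<k (ℕP.≤-pred k≤c))) (ℚP.+-inverseʳ 0ℚ)
      where
      e<k : e < k
      e<k = ℕP.≰⇒> k≰e

    reduced-order : ∀ i j → OrderGe (colOrder j) (reduced i j)
    reduced-order i zero k ()
    reduced-order zero (suc j) = subst (λ c → OrderGe c (reduced zero (suc j))) (ℕP.+-comm 1 (N + n))
      (λ k k≤ → trans (cong (λ t → trunc (d j) (Q₀ ⊛ phi (α j)) k ℚ.+ ℚ.- t) (⊛-comm (phi (α j)) Q₀ k))
        (truncationError-order (d j) (N + n) (Q₀ ⊛ phi (α j)) (λ k d<k k≤ → vanish₀ j k (subst (_≤ k) (ℕP.+-comm 1 (d j)) d<k) k≤) k k≤))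
    reduced-order (suc i) (suc j) = subst (λ c → OrderGe c (reduced (suc i) (suc j))) (ℕP.+-comm 1 (N + n))
      (λ k k≤ → trans (cong (λ t → trunc (d j + δ i j) (Q i ⊛ phi (α j)) k ℚ.+ ℚ.- t) (⊛-comm (phi (α j)) (Q i) k))
        (truncationError-order (d j + δ i j) (N + n) (Q i ⊛ phi (α j))
          (λ k d<k k≤ → vanish i j k (subst (_≤ k) shifted d<k) (ℕP.≤-trans k≤ (ℕP.m≤m+n (N + n) (δ i j)))) k k≤))
      where
      shifted : suc (d j + δ i j) ≡ d j + 1 + δ i j
      shifted = trans (sym (ℕP.+-suc (d j) (δ i j))) (sym (ℕP.+-assoc (d j) 1 (δ i j)))

    Ω-det : ∀ k → det (suc m) Ω k ≡ monomial (Q₀ N ℚ.* prodFinℚ α) T k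
    Ω-det k = trans (det≗det′ (suc m) Ω k) (compare (ℕP.<-cmp k T))
      where
      compare : Tri (k < T) (k ≡ T) (T < k) → S.det′ (suc m) Ω k ≡ monomial (Q₀ N ℚ.* prodFinℚ α) T k
      compare (tri< k<T _ _) = trans (sym (det-reduced k))
        (trans (det-order (suc m) reduced colOrder reduced-order k (subst (k <_) (sym Σ-colOrder) k<T))
               (sym (monomial-off _ T k (ℕP.<⇒≢ k<T))))
      compare (tri≈ _ refl _) = trans (cong (S.det′ (suc m) Ω) (sym Σ-colDegree))
        (trans (det-top (suc m) Ω colDegree Ω-degree) (trans det-top-Ω (sym (monomial-at _ T))))
      compare (tri> _ _ T<k) = trans (det-degree (suc m) Ω colDegree Ω-degree k (subst (_< k) (sym Σ-colDegree) T<k))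
        (sym (monomial-off _ T k (ℕP.<⇒≢ T<k ∘ sym)))


open import Data.Nat using (ℕ; suc; _+_; _*_; _∸_; _≤_)
open import Data.Integer using (ℤ; +_)
open import Data.Rational using (ℚ; 0ℚ; _/_; -_; _-_)
open import Data.Fin using (Fin)
open import Data.Product using (_×_; _,_)
open import Relation.Binary.PropositionalEquality using (_≡_; _≢_; sym; trans)

-- The theorem: a_N ≠ 0 because a_0 = -1/N! ≠ 0, and Ω(z) = a_N α_1⋯α_m z^{m(N+n)+m}.
lemma1 : (m : ℕ) → 1 ≤ m
    → (α : Fin m → ℚ)
    → (∀ i (k : ℕ) → α i ≢ - (+ k / 1))
    → (∀ i j → i ≢ j → ∀ (z : ℤ) → α i - α j ≢ z / 1)
    → (ns : Fin m → ℕ) → (∀ i → 1 ≤ ns i)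
    → (n : ℕ) → (∀ i → ns i ≤ n)
    → (Q₀ : Series) → DegLe (sumFinℕ ns) Q₀
    → Q₀ 0 ≡ minusInvFact (sumFinℕ ns)
    → (∀ j μ → sumFinℕ ns + n ∸ ns j + 1 ≤ μ → μ ≤ sumFinℕ ns + n
         → (Q₀ ⊛ phi (α j)) μ ≡ 0ℚ)
    → (Q : Fin m → Series) → (∀ i → DegLe (sumFinℕ ns) (Q i))
    → (∀ i j μ → sumFinℕ ns + n ∸ ns j + 1 + δ i j ≤ μ → μ ≤ sumFinℕ ns + n + δ i j
         → (Q i ⊛ phi (α j)) μ ≡ 0ℚ)
    → (∀ i → (Q i ⊛ phi (α i)) (sumFinℕ ns + n ∸ ns i + 1) ≡ α i)
    → (Q₀ (sumFinℕ ns) ≢ 0ℚ)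
      × (∀ k → det (suc m) (OmegaMatrix m (sumFinℕ ns) n ns α Q₀ Q) k
           ≡ monomial (Q₀ (sumFinℕ ns) Data.Rational.* prodFinℚ α)
                      (m * (sumFinℕ ns + n) + m) k)
lemma1 m _ α α∉ αdistinct ns _ n ns≤n Q₀ degQ₀ a₀≡ vanish₀ Q degQ vanish topQ =
  LeadingCoefficient.leadingCoefficient≢0 m α α∉ αdistinct ns n ns≤n Q₀ degQ₀ vanish₀ a₀≢0 ,
  OmegaDeterminant.Ω-det m α ns n ns≤n Q₀ degQ₀ vanish₀ Q degQ vanish topQ
  where
  a₀≢0 : Q₀ 0 ≢ 0ℚ
  a₀≢0 a₀≡0 = Rationals.minusInvFact≢0 (sumFinℕ ns) (trans (sym a₀≡) a₀≡0)
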